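{- Let $R$ be a commutative ring, $k,n\ge 1$, and let $A=\{a_{j_1\cdots j_{2k}}\}$ be an alphabet of symbols indexed by $2k$-tuples of positive integers. For positive integers $j_1,\dots,j_{2k}$ put $$\mathbf S(j_1,\dots,j_{2k})=\sum_{\tau\in\mathfrak S_{2k}}\epsilon(\tau)\,a_{j_{\tau(1)}\cdots j_{\tau(2k)}}\in R\langle A\rangle,$$ an alternating tensor of order $2k$ with values in $R\langle A\rangle$. Let $I=(i_1<\cdots<i_{2kn})$ be an increasing sequence of positive integers. Then, in the shuffle algebra $R\langle A\rangle_{\,ш\,}$, $$\sum_{\sigma\in\mathfrak S_{2kn}}\epsilon(\sigma)\,a_{i_{\sigma(1)}\cdots i_{\sigma(2k)}}\,a_{i_{\sigma(2k+1)}\cdots i_{\sigma(4k)}}\cdots a_{i_{\sigma(2(n-1)k+1)}\cdots i_{\sigma(2nk)}}={\rm Pf}^{[2k]}_{\,ш\,}\big(\mathbf S(j_1,\dots,j_{2k})\big)_{j_1,\dots,j_{2k}\in I},$$ where each term on the left is a word of length $n$.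
   Context: $R\langle A\rangle$ is the free $R$-module on words over $A$; the shuffle product is the bilinear product with $u\,ш\,1=1\,ш\,u=u$ and $au\,ш\,bv=a(u\,ш\,bv)+b(au\,ш\,v)$ for letters $a,b$, words $u,v$, making $R\langle A\rangle_{\,ш\,}$ commutative and associative. For an alternating tensor $M$ of order $2k$ indexed by a totally ordered set of size $2kn$ (identified with $\{1,\dots,2kn\}$ in increasing order), the hyperpfaffian is ${\rm Pf}^{[2k]}(M)=\sum_{\sigma\in\mathfrak E_{2kn,2k}}\epsilon(\sigma)\prod_{p=0}^{n-1}M_{\sigma(2kp+1)\cdots\sigma(2kp+2k)}$, where $\mathfrak E_{2kn,2k}$ is the set of $\sigma\in\mathfrak S_{2kn}$ with $\sigma(2kp+1)<\cdots<\sigma(2kp+2k)$ for each $p$ and $\sigma(1)<\sigma(2k+1)<\cdots<\sigma(2k(n-1)+1)$. ${\rm Pf}^{[2k]}_{\,ш\,}$ means the products are shuffle products. -}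

module Defs where

open import Level using (Level)
open import Data.Bool using (Bool; true; false; _∧_; not; if_then_else_)
open import Data.Nat as ℕ using (ℕ; zero; suc; _*_; _<ᵇ_; _≡ᵇ_)
open import Data.Nat.Properties using () renaming (_≟_ to _≟ℕ_)
open import Data.Fin as Fin using (Fin; toℕ; combine)
open import Data.List as List using (List; []; _∷_; allFin; _++_; map; concatMap; filterᵇ; length; foldr; cartesianProduct)
open import Data.List.Properties using () renaming (≡-dec to ≡-decList)
open import Data.Vec as Vec using (Vec; tabulate)
open import Data.Vec.Properties using () renaming (≡-dec to ≡-decVec)
open import Data.Vec.Functional as VF using (Vector)
open import Data.Product using (_×_; _,_; proj₁; proj₂)
open import Relation.Nullary using (does)
open import Relation.Binary.Definitions using (DecidableEquality)
open import Algebra.Bundles using (CommutativeRing)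

allFuns : (m d : ℕ) → List (Fin m → Fin d)
allFuns zero    d = (λ ()) ∷ []
allFuns (suc m) d = concatMap (λ x → map (λ f → x VF.∷ f) (allFuns m d)) (allFin d)

pairs : (m : ℕ) → List (Fin m × Fin m)
pairs m = cartesianProduct (allFin m) (allFin m)

_<F_ : ∀ {m} → Fin m → Fin m → Bool
a <F b = toℕ a <ᵇ toℕ b

_=F_ : ∀ {m} → Fin m → Fin m → Bool
a =F b = toℕ a ≡ᵇ toℕ b

allB : ∀ {A : Set} → (A → Bool) → List A → Bool
allB p = foldr (λ x b → p x ∧ b) true

isPerm : ∀ {m} → (Fin m → Fin m) → Bool
isPerm {m} σ = allB (λ { (a , b) → not ((a <F b) ∧ (σ a =F σ b)) }) (pairs m)

perms : (m : ℕ) → List (Fin m → Fin m)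
perms m = filterᵇ isPerm (allFuns m m)

inversions : ∀ {m} → (Fin m → Fin m) → ℕ
inversions {m} σ = length (filterᵇ (λ { (a , b) → (a <F b) ∧ (σ b <F σ a) }) (pairs m))

even? : ℕ → Bool
even? zero = true
even? (suc n) = not (even? n)

_∨'_ : Bool → Bool → Bool
true ∨' _ = true
false ∨' b = b

-- 𝔈_{2kn,2k}: the position 2k·p + r (0-based; block p, offset r) is
-- Data.Fin.combine p r = p * (2k) + r.
isE : (k n : ℕ) → (Fin (n * (2 * k)) → Fin (n * (2 * k))) → Bool
isE zero    n σ = true
isE (suc k) n σ =
  allB (λ p → allB (λ { (r , s) → not (r <F s) ∨' (σ (combine p r) <F σ (combine p s)) }) (pairs (2 * suc k))) (allFin n)
  ∧ allB (λ { (p , q) → not (p <F q) ∨' (σ (combine p Fin.zero) <F σ (combine q Fin.zero)) }) (pairs n)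

permsE : (k n : ℕ) → List (Fin (n * (2 * k)) → Fin (n * (2 * k)))
permsE k n = filterᵇ (isE k n) (perms (n * (2 * k)))

-- Elements are finite formal linear
-- combinations (lists of (coefficient, word)); two elements are equal
-- iff every word has the same coefficient.

module FreeModule {c ℓ} (R : CommutativeRing c ℓ) (L : Set) (_≟L_ : DecidableEquality L) where
  open CommutativeRing R hiding (_*_)
  open CommutativeRing R using () renaming (_*_ to _*R_)

  Word : Set
  Word = List L

  _≟W_ : DecidableEquality Word
  _≟W_ = ≡-decList _≟L_

  Lin : Set c
  Lin = List (Carrier × Word)

  coeff : Word → Lin → Carrier
  coeff w []              = 0#
  coeff w ((a , v) ∷ xs) = (if does (w ≟W v) then a else 0#) + coeff w xs

  infix 4 _≋_
  _≋_ : Lin → Lin → Set ℓ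
  x ≋ y = ∀ w → coeff w x ≈ coeff w y

  zeroL : Lin
  zeroL = []

  _⊕_ : Lin → Lin → Lin
  _⊕_ = _++_

  _⊙_ : Carrier → Lin → Lin
  a ⊙ x = map (λ { (b , w) → (a *R b , w) }) x

  ⟦_⟧ : Word → Lin
  ⟦ w ⟧ = (1# , w) ∷ []

  oneL : Lin
  oneL = ⟦ [] ⟧

  sumL : ∀ {X : Set} → List X → (X → Lin) → Lin
  sumL xs f = concatMap f xs

  prefix : L → Lin → Lin
  prefix a x = map (λ { (b , w) → (b , a ∷ w) }) x

  shW : Word → Word → Lin
  shW []      v       = ⟦ v ⟧
  shW (a ∷ u) []      = ⟦ a ∷ u ⟧
  shW (a ∷ u) (b ∷ v) = prefix a (shW u (b ∷ v)) ⊕ prefix b (shW (a ∷ u) v)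

  _ш_ : Lin → Lin → Lin
  x ш y = concatMap (λ { (a , u) → concatMap (λ { (b , v) → (a *R b) ⊙ shW u v }) y }) x

  shProd : (n : ℕ) → (Fin n → Lin) → Lin
  shProd zero    f = oneL
  shProd (suc n) f = f Fin.zero ш shProd n (λ p → f (Fin.suc p))

  sgn : ∀ {m} → (Fin m → Fin m) → Carrier
  sgn σ = if even? (inversions σ) then 1# else - 1#

-- The specific setting: letters a_{j₁⋯j₂ₖ} indexed by 2k-tuples of
-- natural numbers (the statement only uses positive indices).

module Setting {c ℓ} (R : CommutativeRing c ℓ) (k : ℕ) where
  Letter : Set
  Letter = Vec ℕ (2 * k)

  open FreeModule R Letter (≡-decVec _≟ℕ_) public
  open CommutativeRing R using (Carrier)

  letter : (Fin (2 * k) → ℕ) → Letter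
  letter = tabulate

  𝐒 : (Fin (2 * k) → ℕ) → Lin
  𝐒 j = sumL (perms (2 * k)) (λ τ → sgn τ ⊙ ⟦ letter (λ r → j (τ r)) ∷ [] ⟧)

  lhs : (n : ℕ) → (Fin (n * (2 * k)) → ℕ) → Lin
  lhs n i = sumL (perms (n * (2 * k)))
    (λ σ → sgn σ ⊙ ⟦ List.map (λ p → letter (λ r → i (σ (combine p r)))) (allFin n) ⟧)

  PfШ : (n : ℕ) → ((Fin (2 * k) → ℕ) → Lin) → (Fin (n * (2 * k)) → ℕ) → Lin
  PfШ n M i = sumL (permsE k n)
    (λ σ → sgn σ ⊙ shProd n (λ p → M (λ r → i (σ (combine p r)))))

{-# OPTIONS --safe #-}
module Submission where

-- Compare the coefficients of a word w on both sides. The shuffle of n one-letter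
-- elements x₁ ш ⋯ ш xₙ is the sum, over the n! ways α of assigning the factor p to
-- position α p of the word, of the products of the coefficients; expanding each
-- 𝐒 adds a permutation τ_p of the 2k entries of each block. So the coefficient of
-- w on the right is a sum over triples (σ, α, τ) with σ ∈ 𝔈. Sending a triple to
-- σ composed with "move block p to position α p and permute it by τ_p" is a
-- bijection onto 𝔖_{2kn}: the inverse sorts each block and then orders the blocks
-- by their smallest entries. The sign of the composite is ε(σ) ∏ ε(τ_p), because
-- moving blocks of even length is an even permutation, and its word is the word
-- of the triple, so the two coefficients agree term by term.

open import Level using (Level; 0ℓ; _⊔_)
open import Function using (_∘_; id; const; mk⇔; Equivalence)
open import Function.Definitions using (Injective)
open import Data.Bool using (Bool; true; false; _∧_; not; if_then_else_)
open import Data.Bool.Properties using (∧-conicalˡ; ∧-conicalʳ; ∧-identityʳ; ⇔→≡; T-≡)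
open import Data.Empty using (⊥; ⊥-elim)
open import Data.Nat as ℕ using (ℕ; zero; suc)
import Data.Nat.Properties as ℕ
open import Data.Fin as Fin using (Fin; toℕ; combine; remQuot; punchIn; punchOut)
import Data.Fin.Properties as Fin
open import Data.Fin.Permutation using (Permutation′; permutation; _⟨$⟩ʳ_)
open import Data.Maybe as Maybe using (Maybe; just; nothing; fromMaybe)
open import Data.List as List using (List; []; _∷_; _++_; map; concatMap; filterᵇ; allFin; tabulate; cartesianProduct; length)
open import Data.List.Relation.Unary.All as All using (All; []; _∷_)
import Data.List.Relation.Unary.All.Properties as All
import Data.List.Properties as List
open import Data.Vec.Functional as Vector using (Vector)
import Data.Vec.Functional.Relation.Binary.Pointwise.Properties as Pointwise
import Data.Vec.Properties as Vec
open import Data.Product using (_×_; _,_; proj₁; proj₂; ∃; uncurry)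
open import Data.Product.Relation.Binary.Pointwise.NonDependent using (×-decSetoid)
open import Relation.Nullary using (Dec; yes; no; does; ¬_)
open import Relation.Nullary.Decidable using (does-⇔; _×-dec_)
open import Relation.Binary.Core using (_Preserves_⟶_)
open import Relation.Binary.Bundles using (DecSetoid)
open import Relation.Binary.Definitions using (DecidableEquality; tri<; tri≈; tri>)
open import Relation.Binary.PropositionalEquality as ≡ using (_≡_; _≢_)
open import Algebra.Bundles using (CommutativeSemiring; CommutativeRing)
open import Defs

∧-intro : ∀ {a b} → a ≡ true → b ≡ true → a ∧ b ≡ true
∧-intro ≡.refl ≡.refl = ≡.refl

implies⇒ : ∀ {a b} → (not a ∨' b) ≡ true → a ≡ true → b ≡ true
implies⇒ {true} h ≡.refl = h

⇒implies : ∀ {a b} → (a ≡ true → b ≡ true) → (not a ∨' b) ≡ true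
⇒implies {false} _ = ≡.refl
⇒implies {true}  h = h ≡.refl

nand⇒¬both : ∀ {x y} → not (x ∧ y) ≡ true → x ≡ true → y ≡ true → ⊥
nand⇒¬both {true} {true} () _ _

does⇒ : ∀ {p} {A : Set p} (a? : Dec A) → does a? ≡ true → A
does⇒ (yes a) _ = a

¬does⇒ : ∀ {p} {A : Set p} (a? : Dec A) → does a? ≡ false → ¬ A
¬does⇒ (no ¬a) _ = ¬a

<ᵇ⇒< : ∀ {m n} → (m ℕ.<ᵇ n) ≡ true → m ℕ.< n
<ᵇ⇒< {m} {n} h = ℕ.<ᵇ⇒< m n (Equivalence.from T-≡ h)

<⇒<ᵇ : ∀ {m n} → m ℕ.< n → (m ℕ.<ᵇ n) ≡ true
<⇒<ᵇ m<n = Equivalence.to T-≡ (ℕ.<⇒<ᵇ m<n)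

≮⇒<ᵇ : ∀ {m n} → ¬ m ℕ.< n → (m ℕ.<ᵇ n) ≡ false
≮⇒<ᵇ {m} {n} m≮n with m ℕ.<ᵇ n in eq
... | true  = ⊥-elim (m≮n (<ᵇ⇒< eq))
... | false = ≡.refl

=F⇒≡ : ∀ {m} {a b : Fin m} → (a =F b) ≡ true → a ≡ b
=F⇒≡ {a = a} {b} h = Fin.toℕ-injective (ℕ.≡ᵇ⇒≡ (toℕ a) (toℕ b) (Equivalence.from T-≡ h))

≡⇒=F : ∀ {m} {a b : Fin m} → a ≡ b → (a =F b) ≡ true
≡⇒=F {a = a} ≡.refl = Equivalence.to T-≡ (ℕ.≡⇒≡ᵇ (toℕ a) (toℕ a) ≡.refl)

All-filterᵇ : ∀ {a p} {X : Set a} {P : X → Set p} (Q : X → Bool) {xs : List X} →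
              All P xs → All (λ x → Q x ≡ true × P x) (filterᵇ Q xs)
All-filterᵇ Q []                 = []
All-filterᵇ Q {x ∷ _} (px ∷ pxs) with Q x in eq
... | true  = (eq , px) ∷ All-filterᵇ Q pxs
... | false = All-filterᵇ Q pxs

module _ {a b p} {X : Set a} {Y : Set b} {P : X × Y → Set p} where

  All-cartesianProduct⁺ : ∀ {xs ys} → All (λ x → All (λ y → P (x , y)) ys) xs → All P (cartesianProduct xs ys)
  All-cartesianProduct⁺ []           = []
  All-cartesianProduct⁺ (pxys ∷ pys) = All.++⁺ (All.map⁺ pxys) (All-cartesianProduct⁺ pys)

  All-cartesianProduct⁻ : ∀ xs {ys} → All P (cartesianProduct xs ys) → All (λ x → All (λ y → P (x , y)) ys) xs
  All-cartesianProduct⁻ []       _ = []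
  All-cartesianProduct⁻ (x ∷ xs) {ys} ps with All.++⁻ (map (x ,_) ys) ps
  ... | pxys , prest = All.map⁻ pxys ∷ All-cartesianProduct⁻ xs prest

module _ {X : Set} (p : X → Bool) where

  allB⇒All : ∀ xs → allB p xs ≡ true → All (λ x → p x ≡ true) xs
  allB⇒All []       _ = []
  allB⇒All (x ∷ xs) h = ∧-conicalˡ _ _ h ∷ allB⇒All xs (∧-conicalʳ _ _ h)

  All⇒allB : ∀ {xs} → All (λ x → p x ≡ true) xs → allB p xs ≡ true
  All⇒allB []         = ≡.refl
  All⇒allB (px ∷ pxs) = ∧-intro px (All⇒allB pxs)

allB-allFin⁻ : ∀ {n} (p : Fin n → Bool) → allB p (allFin n) ≡ true → ∀ i → p i ≡ true
allB-allFin⁻ p h = All.tabulate⁻ (allB⇒All p _ h)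

allB-allFin⁺ : ∀ {n} (p : Fin n → Bool) → (∀ i → p i ≡ true) → allB p (allFin n) ≡ true
allB-allFin⁺ p h = All⇒allB p (All.tabulate⁺ h)

allB-pairs⁻ : ∀ {m} (p : Fin m × Fin m → Bool) → allB p (pairs m) ≡ true → ∀ a b → p (a , b) ≡ true
allB-pairs⁻ {m} p h a b = All.tabulate⁻ (All.tabulate⁻ (All-cartesianProduct⁻ (allFin m) (allB⇒All p _ h)) a) b

allB-pairs⁺ : ∀ {m} (p : Fin m × Fin m → Bool) → (∀ a b → p (a , b) ≡ true) → allB p (pairs m) ≡ true
allB-pairs⁺ p h = All⇒allB p (All-cartesianProduct⁺ (All.tabulate⁺ (λ a → All.tabulate⁺ (h a))))

allᵇ : ∀ {a} {X : Set a} {n} → (X → Bool) → Vector X n → Bool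
allᵇ P = Vector.foldr (λ x b → P x ∧ b) true

allᵇ-sound : ∀ {a} {X : Set a} {n} (P : X → Bool) (f : Vector X n) → allᵇ P f ≡ true → ∀ i → P (f i) ≡ true
allᵇ-sound P f h Fin.zero    = ∧-conicalˡ _ _ h
allᵇ-sound P f h (Fin.suc i) = allᵇ-sound P (f ∘ Fin.suc) (∧-conicalʳ _ _ h) i

allᵇ-complete : ∀ {a} {X : Set a} {n} (P : X → Bool) (f : Vector X n) → (∀ i → P (f i) ≡ true) → allᵇ P f ≡ true
allᵇ-complete {n = zero}  P f h = ≡.refl
allᵇ-complete {n = suc n} P f h = ∧-intro (h Fin.zero) (allᵇ-complete P (f ∘ Fin.suc) (h ∘ Fin.suc))

allᵇ-true : ∀ {a} {X : Set a} {n} (f : Vector X n) → allᵇ (const true) f ≡ true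
allᵇ-true {n = zero}  f = ≡.refl
allᵇ-true {n = suc n} f = allᵇ-true (f ∘ Fin.suc)

-- (λ ()) rather than Vector.[], so that allFuns m d and tuples m (allFin d) agree definitionally.
tuples : ∀ {a} {X : Set a} (n : ℕ) → List X → List (Vector X n)
tuples zero    xs = (λ ()) ∷ []
tuples (suc n) xs = concatMap (λ x → map (x Vector.∷_) (tuples n xs)) xs

allFuns≡tuples : ∀ m d → allFuns m d ≡ tuples m (allFin d)
allFuns≡tuples zero    d = ≡.refl
allFuns≡tuples (suc m) d = ≡.cong (λ fs → concatMap (λ x → map (x Vector.∷_) fs) (allFin d)) (allFuns≡tuples m d)

module ListSum {c ℓ} (S : CommutativeSemiring c ℓ) where
  open CommutativeSemiring S
  open import Algebra.Properties.CommutativeSemigroup +-commutativeSemigroup using (x∙yz≈y∙xz)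
  open import Relation.Binary.Reasoning.Setoid setoid
  open import Algebra.Properties.Semiring.Sum semiring public

  ∑ₗ : ∀ {a} {X : Set a} → List X → (X → Carrier) → Carrier
  ∑ₗ []       f = 0#
  ∑ₗ (x ∷ xs) f = f x + ∑ₗ xs f

  infixl 10 ∑ₗ
  syntax ∑ₗ xs (λ x → e) = ∑[ x ∈ xs ] e

  open import Algebra.Properties.CommutativeMonoid.Sum *-commutativeMonoid public
    using () renaming (sum to product; sum-cong-≋ to product-cong; ∑-distrib-+ to ∏-distrib-*; ∑-permute to ∏-permute)

  ∏ : ∀ n → Vector Carrier n → Carrier
  ∏ n = product

  infixl 10 ∏
  syntax ∏ n (λ i → x) = ∏[ i < n ] x

  𝟙 : Bool → Carrier
  𝟙 true  = 1#
  𝟙 false = 0#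

  𝟙-∧ : ∀ a b → 𝟙 (a ∧ b) ≈ 𝟙 a * 𝟙 b
  𝟙-∧ true  b = sym (*-identityˡ _)
  𝟙-∧ false b = sym (zeroˡ _)

  module _ {a} {X : Set a} where

    ∑ₗ-cong : (xs : List X) {f g : X → Carrier} → (∀ x → f x ≈ g x) → ∑ₗ xs f ≈ ∑ₗ xs g
    ∑ₗ-cong []       f≈g = refl
    ∑ₗ-cong (x ∷ xs) f≈g = +-cong (f≈g x) (∑ₗ-cong xs f≈g)

    ∑ₗ-cong-All : ∀ {p} {P : X → Set p} {xs : List X} {f g : X → Carrier} →
                  All P xs → (∀ x → P x → f x ≈ g x) → ∑ₗ xs f ≈ ∑ₗ xs g
    ∑ₗ-cong-All []         f≈g = refl
    ∑ₗ-cong-All (px ∷ pxs) f≈g = +-cong (f≈g _ px) (∑ₗ-cong-All pxs f≈g)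

    ∑ₗ-++ : (xs ys : List X) (f : X → Carrier) → ∑ₗ (xs ++ ys) f ≈ ∑ₗ xs f + ∑ₗ ys f
    ∑ₗ-++ []       ys f = sym (+-identityˡ _)
    ∑ₗ-++ (x ∷ xs) ys f = trans (+-congˡ (∑ₗ-++ xs ys f)) (sym (+-assoc _ _ _))

    ∑ₗ-zero : (xs : List X) → ∑[ x ∈ xs ] 0# ≈ 0#
    ∑ₗ-zero []       = refl
    ∑ₗ-zero (x ∷ xs) = trans (+-identityˡ _) (∑ₗ-zero xs)

    ∑ₗ-distrib-+ : (xs : List X) (f g : X → Carrier) → ∑[ x ∈ xs ] (f x + g x) ≈ ∑ₗ xs f + ∑ₗ xs g
    ∑ₗ-distrib-+ []       f g = sym (+-identityˡ _)
    ∑ₗ-distrib-+ (x ∷ xs) f g = begin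
      (f x + g x) + ∑[ y ∈ xs ] (f y + g y) ≈⟨ +-congˡ (∑ₗ-distrib-+ xs f g) ⟩
      (f x + g x) + (∑ₗ xs f + ∑ₗ xs g)     ≈⟨ +-assoc _ _ _ ⟩
      f x + (g x + (∑ₗ xs f + ∑ₗ xs g))     ≈⟨ +-congˡ (x∙yz≈y∙xz _ _ _) ⟩
      f x + (∑ₗ xs f + (g x + ∑ₗ xs g))     ≈⟨ +-assoc _ _ _ ⟨
      (f x + ∑ₗ xs f) + (g x + ∑ₗ xs g)     ∎

    *-distribˡ-∑ₗ : (xs : List X) (a : Carrier) (f : X → Carrier) → a * ∑ₗ xs f ≈ ∑[ x ∈ xs ] (a * f x)
    *-distribˡ-∑ₗ []       a f = zeroʳ a
    *-distribˡ-∑ₗ (x ∷ xs) a f = trans (distribˡ a _ _) (+-congˡ (*-distribˡ-∑ₗ xs a f))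

    *-distribʳ-∑ₗ : (xs : List X) (a : Carrier) (f : X → Carrier) → ∑ₗ xs f * a ≈ ∑[ x ∈ xs ] (f x * a)
    *-distribʳ-∑ₗ xs a f = trans (*-comm _ a) (trans (*-distribˡ-∑ₗ xs a f) (∑ₗ-cong xs (λ x → *-comm a (f x))))

    ∑ₗ-map : ∀ {b} {Y : Set b} (h : Y → X) (ys : List Y) (f : X → Carrier) → ∑ₗ (map h ys) f ≡ ∑ₗ ys (f ∘ h)
    ∑ₗ-map h []       f = ≡.refl
    ∑ₗ-map h (y ∷ ys) f = ≡.cong (f (h y) +_) (∑ₗ-map h ys f)

    ∑ₗ-filter : (p : X → Bool) (xs : List X) (f : X → Carrier) → ∑ₗ (filterᵇ p xs) f ≈ ∑[ x ∈ xs ] (𝟙 (p x) * f x)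
    ∑ₗ-filter p []       f = refl
    ∑ₗ-filter p (x ∷ xs) f with p x
    ... | true  = +-cong (sym (*-identityˡ _)) (∑ₗ-filter p xs f)
    ... | false = trans (∑ₗ-filter p xs f) (trans (sym (+-identityˡ _)) (+-congʳ (sym (zeroˡ _))))

    ∑ₗ-tabulate : ∀ {n} (g : Fin n → X) (f : X → Carrier) → ∑ₗ (tabulate g) f ≡ ∑[ i < n ] f (g i)
    ∑ₗ-tabulate {zero}  g f = ≡.refl
    ∑ₗ-tabulate {suc n} g f = ≡.cong (f (g Fin.zero) +_) (∑ₗ-tabulate (g ∘ Fin.suc) f)

  ∑ₗ-tabulate-suc : ∀ {n} (f : Fin (suc n) → Carrier) → ∑ₗ (tabulate Fin.suc) f ≡ ∑[ j ∈ allFin n ] f (Fin.suc j)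
  ∑ₗ-tabulate-suc {n} f = ≡.trans (≡.cong (λ xs → ∑ₗ xs f) (≡.sym (List.map-tabulate id Fin.suc))) (∑ₗ-map Fin.suc (allFin n) f)

  ∑ₗ-allFin : ∀ {n} (f : Fin n → Carrier) → ∑ₗ (allFin n) f ≡ ∑[ i < n ] f i
  ∑ₗ-allFin = ∑ₗ-tabulate id

  module _ {a b} {X : Set a} {Y : Set b} where

    ∑ₗ-concatMap : (h : Y → List X) (ys : List Y) (f : X → Carrier) → ∑ₗ (concatMap h ys) f ≈ ∑[ y ∈ ys ] ∑ₗ (h y) f
    ∑ₗ-concatMap h []       f = refl
    ∑ₗ-concatMap h (y ∷ ys) f = trans (∑ₗ-++ (h y) (concatMap h ys) f) (+-congˡ (∑ₗ-concatMap h ys f))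

    ∑ₗ-cartesianProduct : (xs : List X) (ys : List Y) (f : X × Y → Carrier) →
                          ∑ₗ (cartesianProduct xs ys) f ≈ ∑[ x ∈ xs ] ∑[ y ∈ ys ] f (x , y)
    ∑ₗ-cartesianProduct []       ys f = refl
    ∑ₗ-cartesianProduct (x ∷ xs) ys f = begin
      ∑ₗ (map (x ,_) ys ++ cartesianProduct xs ys) f             ≈⟨ ∑ₗ-++ (map (x ,_) ys) _ f ⟩
      ∑ₗ (map (x ,_) ys) f + ∑ₗ (cartesianProduct xs ys) f       ≈⟨ +-cong (reflexive (∑ₗ-map (x ,_) ys f)) (∑ₗ-cartesianProduct xs ys f) ⟩
      ∑[ y ∈ ys ] f (x , y) + ∑[ x′ ∈ xs ] ∑[ y ∈ ys ] f (x′ , y) ∎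

    ∑ₗ*∑ₗ≈∑ₗ∑ₗ : (xs : List X) (ys : List Y) (f : X → Carrier) (g : Y → Carrier) →
                 ∑ₗ xs f * ∑ₗ ys g ≈ ∑[ x ∈ xs ] ∑[ y ∈ ys ] (f x * g y)
    ∑ₗ*∑ₗ≈∑ₗ∑ₗ xs ys f g = trans (*-distribʳ-∑ₗ xs _ f) (∑ₗ-cong xs (λ x → *-distribˡ-∑ₗ ys (f x) g))

    *-distribˡ-∑ₗ∑ₗ : (xs : List X) (ys : List Y) (a : Carrier) (h : X → Y → Carrier) →
                     a * ∑[ x ∈ xs ] ∑[ y ∈ ys ] h x y ≈ ∑[ x ∈ xs ] ∑[ y ∈ ys ] (a * h x y)
    *-distribˡ-∑ₗ∑ₗ xs ys a h = trans (*-distribˡ-∑ₗ xs a _) (∑ₗ-cong xs (λ x → *-distribˡ-∑ₗ ys a (h x)))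

    ∑ₗ-comm : (xs : List X) (ys : List Y) (h : X → Y → Carrier) →
              ∑[ x ∈ xs ] ∑[ y ∈ ys ] h x y ≈ ∑[ y ∈ ys ] ∑[ x ∈ xs ] h x y
    ∑ₗ-comm []       ys h = sym (∑ₗ-zero ys)
    ∑ₗ-comm (x ∷ xs) ys h = trans (+-congˡ (∑ₗ-comm xs ys h)) (sym (∑ₗ-distrib-+ ys (h x) (λ y → ∑[ x′ ∈ xs ] h x′ y)))

  ∏∑ₗ≈∑ₗ∏ : ∀ n {a} {X : Set a} (xs : List X) (g : Fin n → X → Carrier) →
           ∏[ p < n ] ∑[ x ∈ xs ] g p x ≈ ∑[ τ ∈ tuples n xs ] ∏[ p < n ] g p (τ p)
  ∏∑ₗ≈∑ₗ∏ zero    xs g = sym (+-identityʳ _)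
  ∏∑ₗ≈∑ₗ∏ (suc n) xs g = begin
    ∑[ x ∈ xs ] g Fin.zero x * ∏[ p < n ] ∑[ x ∈ xs ] g (Fin.suc p) x
      ≈⟨ *-congˡ (∏∑ₗ≈∑ₗ∏ n xs (g ∘ Fin.suc)) ⟩
    ∑[ x ∈ xs ] g Fin.zero x * ∑[ τ ∈ T ] ∏[ p < n ] g (Fin.suc p) (τ p)
      ≈⟨ ∑ₗ*∑ₗ≈∑ₗ∑ₗ xs T _ _ ⟩
    ∑[ x ∈ xs ] ∑[ τ ∈ T ] (g Fin.zero x * ∏[ p < n ] g (Fin.suc p) (τ p))
      ≈⟨ ∑ₗ-cong xs (λ x → reflexive (∑ₗ-map (x Vector.∷_) T (λ τ → ∏[ p < suc n ] g p (τ p)))) ⟨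
    ∑[ x ∈ xs ] ∑ₗ (map (x Vector.∷_) T) (λ τ → ∏[ p < suc n ] g p (τ p))
      ≈⟨ ∑ₗ-concatMap (λ x → map (x Vector.∷_) T) xs _ ⟨
    ∑[ τ ∈ tuples (suc n) xs ] ∏[ p < suc n ] g p (τ p) ∎
    where T = tuples n xs

  ∑-select : ∀ {n} (p : Fin n) (G : Fin n → Carrier) → ∑[ q < n ] (𝟙 (does (q Fin.≟ p)) * G q) ≈ G p
  ∑-select {suc n} Fin.zero G = begin
    1# * G Fin.zero + ∑[ q < n ] (0# * G (Fin.suc q)) ≈⟨ +-cong (*-identityˡ _) (sum-cong-≋ {n} (λ q → zeroˡ _)) ⟩
    G Fin.zero + sum {n} (λ _ → 0#)                   ≈⟨ +-congˡ (sum-replicate-zero n) ⟩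
    G Fin.zero + 0#                                    ≈⟨ +-identityʳ _ ⟩
    G Fin.zero                                         ∎
  ∑-select {suc n} (Fin.suc p) G =
    trans (+-cong (zeroˡ _) (∑-select p (G ∘ Fin.suc))) (+-identityˡ _)

  ∑-splitAt : ∀ a b (F : Fin (a ℕ.+ b) → Carrier) →
              ∑[ i < a ℕ.+ b ] F i ≈ ∑[ i < a ] F (i Fin.↑ˡ b) + ∑[ j < b ] F (a Fin.↑ʳ j)
  ∑-splitAt zero    b F = sym (+-identityˡ _)
  ∑-splitAt (suc a) b F = trans (+-congˡ (∑-splitAt a b (F ∘ Fin.suc))) (sym (+-assoc _ _ _))

  ∑-combine : ∀ n m (F : Fin (n ℕ.* m) → Carrier) → ∑[ i < n ℕ.* m ] F i ≈ ∑[ p < n ] ∑[ r < m ] F (combine p r)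
  ∑-combine zero    m F = refl
  ∑-combine (suc n) m F = trans (∑-splitAt m (n ℕ.* m) F) (+-congˡ (∑-combine n m (F ∘ (m Fin.↑ʳ_))))

-- Permutations of Fin m

Endo : ℕ → DecSetoid 0ℓ 0ℓ
Endo n = Pointwise.decSetoid (Fin.≡-decSetoid n) n

module _ {m : ℕ} where

  isPerm⇒injective : (σ : Fin m → Fin m) → isPerm σ ≡ true → Injective _≡_ _≡_ σ
  isPerm⇒injective σ h {a} {b} σa≡σb with Fin.<-cmp a b
  ... | tri≈ _ a≡b _ = a≡b
  ... | tri< a<b _ _ = ⊥-elim (nand⇒¬both (allB-pairs⁻ _ h a b) (<⇒<ᵇ a<b) (≡⇒=F σa≡σb))
  ... | tri> _ _ b<a = ⊥-elim (nand⇒¬both (allB-pairs⁻ _ h b a) (<⇒<ᵇ b<a) (≡⇒=F (≡.sym σa≡σb)))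

  injective⇒isPerm : (σ : Fin m → Fin m) → Injective _≡_ _≡_ σ → isPerm σ ≡ true
  injective⇒isPerm σ σ-inj = allB-pairs⁺ _ noCollision
    where
    noCollision : ∀ a b → not ((a <F b) ∧ (σ a =F σ b)) ≡ true
    noCollision a b with a <F b in a<b | σ a =F σ b in σa=σb
    ... | false | _     = ≡.refl
    ... | true  | false = ≡.refl
    ... | true  | true  = ⊥-elim (ℕ.<-irrefl (≡.cong toℕ (σ-inj (=F⇒≡ σa=σb))) (<ᵇ⇒< a<b))

  isPerm-cong : {σ τ : Fin m → Fin m} → (∀ x → σ x ≡ τ x) → isPerm σ ≡ isPerm τ
  isPerm-cong {σ} {τ} σ≗τ = ⇔→≡ {z = true} (mk⇔
    (λ h → injective⇒isPerm τ (λ {a} {b} e → isPerm⇒injective σ h (≡.trans (σ≗τ a) (≡.trans e (≡.sym (σ≗τ b))))))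
    (λ h → injective⇒isPerm σ (λ {a} {b} e → isPerm⇒injective τ h (≡.trans (≡.sym (σ≗τ a)) (≡.trans e (σ≗τ b))))))

firstIndex : ∀ {m} → (Fin m → Bool) → Maybe (Fin m)
firstIndex {zero}  P = nothing
firstIndex {suc m} P = if P Fin.zero then just Fin.zero else Maybe.map Fin.suc (firstIndex (P ∘ Fin.suc))

firstIndex-cong : ∀ {m} {P Q : Fin m → Bool} → (∀ r → P r ≡ Q r) → firstIndex P ≡ firstIndex Q
firstIndex-cong {zero}  P≗Q = ≡.refl
firstIndex-cong {suc m} {P} {Q} P≗Q rewrite P≗Q Fin.zero | firstIndex-cong {P = P ∘ Fin.suc} {Q ∘ Fin.suc} (P≗Q ∘ Fin.suc) = ≡.refl

firstIndex-just : ∀ {m} (P : Fin m → Bool) {r} → firstIndex P ≡ just r → P r ≡ true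
firstIndex-just {suc m} P h with P Fin.zero in eq
firstIndex-just {suc m} P ≡.refl | true = eq
... | false with firstIndex (P ∘ Fin.suc) in eq′
firstIndex-just {suc m} P ≡.refl | false | just r = firstIndex-just (P ∘ Fin.suc) eq′

firstIndex-nothing : ∀ {m} (P : Fin m → Bool) → firstIndex P ≡ nothing → ∀ r → P r ≡ false
firstIndex-nothing {suc m} P h r with P Fin.zero in eq
firstIndex-nothing {suc m} P () r | true
... | false with firstIndex (P ∘ Fin.suc) in eq′
firstIndex-nothing {suc m} P h Fin.zero    | false | nothing = eq
firstIndex-nothing {suc m} P h (Fin.suc r) | false | nothing = firstIndex-nothing (P ∘ Fin.suc) eq′ r

injective⇒surjective : ∀ {m} (σ : Fin m → Fin m) → Injective _≡_ _≡_ σ → ∀ s → ¬ (∀ r → σ r ≢ s)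
injective⇒surjective {suc m} σ σ-inj s missed
  with i , j , i<j , eq ← Fin.pigeonhole (ℕ.n<1+n m) (λ r → punchOut (missed r ∘ ≡.sym))
  = Fin.<-irrefl (σ-inj (Fin.punchOut-injective (missed i ∘ ≡.sym) (missed j ∘ ≡.sym) eq)) i<j

opaque
  -- The fallback value s is only reached when s has no preimage, which never happens for injective σ.
  inverse : ∀ {m} → (Fin m → Fin m) → Fin m → Fin m
  inverse σ s = fromMaybe s (firstIndex (λ r → does (σ r Fin.≟ s)))

  inverse-cong : ∀ {m} {σ τ : Fin m → Fin m} → (∀ x → σ x ≡ τ x) → ∀ s → inverse σ s ≡ inverse τ s
  inverse-cong σ≗τ s = ≡.cong (fromMaybe s) (firstIndex-cong (λ r → ≡.cong (λ t → does (t Fin.≟ s)) (σ≗τ r)))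

  inverseʳ : ∀ {m} {σ : Fin m → Fin m} → Injective _≡_ _≡_ σ → ∀ s → σ (inverse σ s) ≡ s
  inverseʳ {σ = σ} σ-inj s with firstIndex (λ r → does (σ r Fin.≟ s)) in eq
  ... | just r  = does⇒ (σ r Fin.≟ s) (firstIndex-just _ eq)
  ... | nothing = ⊥-elim (injective⇒surjective σ σ-inj s (λ r → ¬does⇒ (σ r Fin.≟ s) (firstIndex-nothing _ eq r)))

module _ {m : ℕ} where

  inverseˡ : {σ : Fin m → Fin m} → Injective _≡_ _≡_ σ → ∀ r → inverse σ (σ r) ≡ r
  inverseˡ {σ} σ-inj r = σ-inj (inverseʳ σ-inj (σ r))

  inverse-injective : {σ : Fin m → Fin m} → Injective _≡_ _≡_ σ → Injective _≡_ _≡_ (inverse σ)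
  inverse-injective {σ} σ-inj {a} {b} e = ≡.trans (≡.sym (inverseʳ σ-inj a)) (≡.trans (≡.cong σ e) (inverseʳ σ-inj b))

  inverse-involutive : {σ : Fin m → Fin m} → Injective _≡_ _≡_ σ → ∀ r → inverse (inverse σ) r ≡ σ r
  inverse-involutive σ-inj r = inverse-injective σ-inj
    (≡.trans (inverseʳ (inverse-injective σ-inj) r) (≡.sym (inverseˡ σ-inj r)))

  toPermutation : {σ : Fin m → Fin m} → Injective _≡_ _≡_ σ → Permutation′ m
  toPermutation {σ} σ-inj = permutation σ (inverse σ) (inverseʳ σ-inj) (inverseˡ σ-inj)

-- Sums over lists enumerating a set up to a decidable equivalence, and their reindexing

record Correspondence (A B : DecSetoid 0ℓ 0ℓ) (P : DecSetoid.Carrier A → Bool) (Q : DecSetoid.Carrier B → Bool) : Set where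
  private
    module A = DecSetoid A
    module B = DecSetoid B
  field
    to          : A.Carrier → B.Carrier
    from        : B.Carrier → A.Carrier
    to-cong     : to Preserves A._≈_ ⟶ B._≈_
    from-cong   : from Preserves B._≈_ ⟶ A._≈_
    to-closed   : ∀ {x} → P x ≡ true → Q (to x) ≡ true
    from-closed : ∀ {y} → Q y ≡ true → P (from y) ≡ true
    from∘to     : ∀ {x} → P x ≡ true → from (to x) A.≈ x
    to∘from     : ∀ {y} → Q y ≡ true → to (from y) B.≈ y

module Enumeration {c ℓ} (S : CommutativeSemiring c ℓ) where
  open CommutativeSemiring S
  open ListSum S
  open import Relation.Binary.Reasoning.Setoid setoid
  open DecSetoid using () renaming (Carrier to ∣_∣)

  -- Multiplicities are counted in S itself, which is all that reindexing a sum needs.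
  record Enumerates (A : DecSetoid 0ℓ 0ℓ) (P : ∣ A ∣ → Bool) (xs : List ∣ A ∣) : Set (c ⊔ ℓ) where
    open DecSetoid A using (_≟_)
    field
      members      : All (λ x → P x ≡ true) xs
      multiplicity : ∀ z → ∑[ x ∈ xs ] 𝟙 (does (x ≟ z)) ≈ 𝟙 (P z)
  open Enumerates

  open Correspondence

  module _ {A : DecSetoid 0ℓ 0ℓ} where
    open DecSetoid A using (_≟_) renaming (_≈_ to _≈ᴬ_)

    ∑ₗ-select : ∀ {P xs} → Enumerates A P xs → (F : ∣ A ∣ → Carrier) → F Preserves _≈ᴬ_ ⟶ _≈_ →
                ∀ z → ∑[ x ∈ xs ] (𝟙 (does (x ≟ z)) * F x) ≈ 𝟙 (P z) * F z
    ∑ₗ-select {P} {xs} e F F-cong z = begin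
      ∑[ x ∈ xs ] (𝟙 (does (x ≟ z)) * F x) ≈⟨ ∑ₗ-cong xs pick ⟩
      ∑[ x ∈ xs ] (𝟙 (does (x ≟ z)) * F z) ≈⟨ *-distribʳ-∑ₗ xs (F z) _ ⟨
      ∑[ x ∈ xs ] 𝟙 (does (x ≟ z)) * F z   ≈⟨ *-congʳ (multiplicity e z) ⟩
      𝟙 (P z) * F z                         ∎
      where
      pick : ∀ x → 𝟙 (does (x ≟ z)) * F x ≈ 𝟙 (does (x ≟ z)) * F z
      pick x with x ≟ z
      ... | yes x≈z = *-congˡ (F-cong x≈z)
      ... | no  _   = trans (zeroˡ _) (sym (zeroˡ _))

    Enumerates-cong : ∀ {P Q xs} → (∀ x → P x ≡ Q x) → Enumerates A P xs → Enumerates A Q xs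
    Enumerates-cong P≗Q e = record
      { members      = All.map (λ {x} Px → ≡.trans (≡.sym (P≗Q x)) Px) (members e)
      ; multiplicity = λ z → trans (multiplicity e z) (reflexive (≡.cong 𝟙 (P≗Q z)))
      }

    filter-enumerates : ∀ {P xs} → Enumerates A P xs → (Q : ∣ A ∣ → Bool) → (∀ {x y} → x ≈ᴬ y → Q x ≡ Q y) →
                        Enumerates A (λ x → Q x ∧ P x) (filterᵇ Q xs)
    filter-enumerates {P} {xs} e Q Q-cong = record
      { members      = All.map (uncurry ∧-intro) (All-filterᵇ Q (members e))
      ; multiplicity = λ z → begin
          ∑[ x ∈ filterᵇ Q xs ] 𝟙 (does (x ≟ z))   ≈⟨ ∑ₗ-filter Q xs _ ⟩
          ∑[ x ∈ xs ] (𝟙 (Q x) * 𝟙 (does (x ≟ z)))  ≈⟨ ∑ₗ-cong xs (λ x → *-comm _ _) ⟩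
          ∑[ x ∈ xs ] (𝟙 (does (x ≟ z)) * 𝟙 (Q x))  ≈⟨ ∑ₗ-select e (𝟙 ∘ Q) (reflexive ∘ ≡.cong 𝟙 ∘ Q-cong) z ⟩
          𝟙 (P z) * 𝟙 (Q z)                          ≈⟨ *-comm _ _ ⟩
          𝟙 (Q z) * 𝟙 (P z)                          ≈⟨ 𝟙-∧ (Q z) (P z) ⟨
          𝟙 (Q z ∧ P z)                              ∎
      }

  allFin-enumerates : ∀ n → Enumerates (Fin.≡-decSetoid n) (const true) (allFin n)
  allFin-enumerates n = record
    { members      = All.tabulate⁺ (λ _ → ≡.refl)
    ; multiplicity = λ z → begin
        ∑[ x ∈ allFin n ] 𝟙 (does (x Fin.≟ z))  ≡⟨ ∑ₗ-allFin (λ x → 𝟙 (does (x Fin.≟ z))) ⟩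
        ∑[ x < n ] 𝟙 (does (x Fin.≟ z))        ≈⟨ sum-cong-≋ {n} (λ _ → *-identityʳ _) ⟨
        ∑[ x < n ] (𝟙 (does (x Fin.≟ z)) * 1#) ≈⟨ ∑-select z (const 1#) ⟩
        1#                                     ∎
    }

  module _ {A B : DecSetoid 0ℓ 0ℓ} where
    private
      module A = DecSetoid A
      module B = DecSetoid B

    cartesianProduct-enumerates : ∀ {P Q xs ys} → Enumerates A P xs → Enumerates B Q ys →
      Enumerates (×-decSetoid A B) (λ xy → P (proj₁ xy) ∧ Q (proj₂ xy)) (cartesianProduct xs ys)
    cartesianProduct-enumerates {P} {Q} {xs} {ys} eA eB = record
      { members      = All-cartesianProduct⁺ (All.map (λ Pa → All.map (∧-intro Pa) (members eB)) (members eA))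
      ; multiplicity = λ { (a , b) → begin
          ∑[ xy ∈ cartesianProduct xs ys ] 𝟙 (does (proj₁ xy A.≟ a) ∧ does (proj₂ xy B.≟ b))
            ≈⟨ ∑ₗ-cartesianProduct xs ys _ ⟩
          ∑[ x ∈ xs ] ∑[ y ∈ ys ] 𝟙 (does (x A.≟ a) ∧ does (y B.≟ b))
            ≈⟨ ∑ₗ-cong xs (λ x → ∑ₗ-cong ys (λ y → 𝟙-∧ (does (x A.≟ a)) (does (y B.≟ b)))) ⟩
          ∑[ x ∈ xs ] ∑[ y ∈ ys ] (𝟙 (does (x A.≟ a)) * 𝟙 (does (y B.≟ b)))
            ≈⟨ ∑ₗ*∑ₗ≈∑ₗ∑ₗ xs ys _ _ ⟨
          ∑[ x ∈ xs ] 𝟙 (does (x A.≟ a)) * ∑[ y ∈ ys ] 𝟙 (does (y B.≟ b))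
            ≈⟨ *-cong (multiplicity eA a) (multiplicity eB b) ⟩
          𝟙 (P a) * 𝟙 (Q b)
            ≈⟨ 𝟙-∧ (P a) (Q b) ⟨
          𝟙 (P a ∧ Q b) ∎ }
      }

  tuples-enumerate : ∀ {A : DecSetoid 0ℓ 0ℓ} {P xs} → Enumerates A P xs → ∀ n →
                     Enumerates (Pointwise.decSetoid A n) (allᵇ P) (tuples n xs)
  tuples-enumerate e zero = record
    { members      = ≡.refl ∷ []
    ; multiplicity = λ _ → +-identityʳ _
    }
  tuples-enumerate {A} {P} {xs} e (suc n) = record
    { members      = All.concat⁺ (All.map⁺ (All.map (λ px → All.map⁺ (All.map (∧-intro px) (members ih))) (members e)))
    ; multiplicity = λ z → begin
        ∑ₗ (concatMap (λ x → map (x Vector.∷_) T) xs) (λ f → 𝟙 (does (f ≟ₙ₊₁ z)))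
          ≈⟨ ∑ₗ-concatMap _ xs _ ⟩
        ∑[ x ∈ xs ] ∑ₗ (map (x Vector.∷_) T) (λ f → 𝟙 (does (f ≟ₙ₊₁ z)))
          ≈⟨ ∑ₗ-cong xs (λ x → reflexive (∑ₗ-map (x Vector.∷_) T _)) ⟩
        ∑[ x ∈ xs ] ∑[ f ∈ T ] 𝟙 (does (x A.≟ z Fin.zero) ∧ does (f ≟ₙ (z ∘ Fin.suc)))
          ≈⟨ ∑ₗ-cong xs (λ x → ∑ₗ-cong T (λ f → 𝟙-∧ (does (x A.≟ z Fin.zero)) (does (f ≟ₙ (z ∘ Fin.suc))))) ⟩
        ∑[ x ∈ xs ] ∑[ f ∈ T ] (𝟙 (does (x A.≟ z Fin.zero)) * 𝟙 (does (f ≟ₙ (z ∘ Fin.suc))))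
          ≈⟨ ∑ₗ*∑ₗ≈∑ₗ∑ₗ xs T _ _ ⟨
        ∑[ x ∈ xs ] 𝟙 (does (x A.≟ z Fin.zero)) * ∑[ f ∈ T ] 𝟙 (does (f ≟ₙ (z ∘ Fin.suc)))
          ≈⟨ *-cong (multiplicity e (z Fin.zero)) (multiplicity ih (z ∘ Fin.suc)) ⟩
        𝟙 (P (z Fin.zero)) * 𝟙 (allᵇ P (z ∘ Fin.suc))
          ≈⟨ 𝟙-∧ (P (z Fin.zero)) (allᵇ P (z ∘ Fin.suc)) ⟨
        𝟙 (allᵇ P z) ∎
    }
    where
    module A = DecSetoid A
    open DecSetoid (Pointwise.decSetoid A n) using () renaming (_≟_ to _≟ₙ_)
    open DecSetoid (Pointwise.decSetoid A (suc n)) using () renaming (_≟_ to _≟ₙ₊₁_)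
    T = tuples n xs
    ih = tuples-enumerate e n

  -- Both sides are ∑_{x,y} [y ≈ to x] F y, summed in the two possible orders.
  ∑ₗ-reindex : ∀ {A B : DecSetoid 0ℓ 0ℓ} {P Q xs ys} → Enumerates A P xs → Enumerates B Q ys →
               (φ : Correspondence A B P Q) (F : ∣ B ∣ → Carrier) → F Preserves DecSetoid._≈_ B ⟶ _≈_ →
               ∑[ x ∈ xs ] F (to φ x) ≈ ∑ₗ ys F
  ∑ₗ-reindex {A} {B} {P} {Q} {xs} {ys} eA eB φ F F-cong = begin
    ∑[ x ∈ xs ] F (to φ x)                                   ≈⟨ ∑ₗ-cong-All (members eA) expand ⟩
    ∑[ x ∈ xs ] ∑[ y ∈ ys ] (𝟙 (does (y B.≟ to φ x)) * F y)  ≈⟨ ∑ₗ-comm xs ys _ ⟩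
    ∑[ y ∈ ys ] ∑[ x ∈ xs ] (𝟙 (does (y B.≟ to φ x)) * F y)  ≈⟨ ∑ₗ-cong-All (members eB) collapse ⟩
    ∑ₗ ys F                                                  ∎
    where
    module A = DecSetoid A
    module B = DecSetoid B

    expand : ∀ x → P x ≡ true → F (to φ x) ≈ ∑[ y ∈ ys ] (𝟙 (does (y B.≟ to φ x)) * F y)
    expand x Px = sym (begin
      ∑[ y ∈ ys ] (𝟙 (does (y B.≟ to φ x)) * F y) ≈⟨ ∑ₗ-select eB F F-cong (to φ x) ⟩
      𝟙 (Q (to φ x)) * F (to φ x)                 ≡⟨ ≡.cong (λ b → 𝟙 b * F (to φ x)) (to-closed φ Px) ⟩
      1# * F (to φ x)                             ≈⟨ *-identityˡ _ ⟩
      F (to φ x)                                  ∎)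

    transpose : ∀ {x y} → P x ≡ true → Q y ≡ true → does (y B.≟ to φ x) ≡ does (x A.≟ from φ y)
    transpose {x} {y} Px Qy = does-⇔
      (mk⇔ (λ y≈φx → A.trans (A.sym (from∘to φ Px)) (from-cong φ (B.sym y≈φx)))
           (λ x≈ψy → B.trans (B.sym (to∘from φ Qy)) (to-cong φ (A.sym x≈ψy))))
      (y B.≟ to φ x) (x A.≟ from φ y)

    collapse : ∀ y → Q y ≡ true → ∑[ x ∈ xs ] (𝟙 (does (y B.≟ to φ x)) * F y) ≈ F y
    collapse y Qy = begin
      ∑[ x ∈ xs ] (𝟙 (does (y B.≟ to φ x)) * F y)
        ≈⟨ ∑ₗ-cong-All (members eA) (λ x Px → reflexive (≡.cong (λ b → 𝟙 b * F y) (transpose Px Qy))) ⟩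
      ∑[ x ∈ xs ] (𝟙 (does (x A.≟ from φ y)) * F y) ≈⟨ *-distribʳ-∑ₗ xs (F y) _ ⟨
      ∑[ x ∈ xs ] 𝟙 (does (x A.≟ from φ y)) * F y   ≈⟨ *-congʳ (multiplicity eA (from φ y)) ⟩
      𝟙 (P (from φ y)) * F y                        ≡⟨ ≡.cong (λ b → 𝟙 b * F y) (from-closed φ Qy) ⟩
      1# * F y                                      ≈⟨ *-identityˡ _ ⟩
      F y                                           ∎

  allFuns-enumerate : ∀ m d → Enumerates (Pointwise.decSetoid (Fin.≡-decSetoid d) m) (const true) (allFuns m d)
  allFuns-enumerate m d = ≡.subst (Enumerates _ _) (≡.sym (allFuns≡tuples m d))
    (Enumerates-cong allᵇ-true (tuples-enumerate (allFin-enumerates d) m))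

  perms-enumerate : ∀ n → Enumerates (Endo n) isPerm (perms n)
  perms-enumerate n = Enumerates-cong (λ σ → ∧-identityʳ (isPerm σ))
    (filter-enumerates (allFuns-enumerate n n) isPerm isPerm-cong)

-- d is a junk value, returned only when j ≡ x, where punchOut is undefined.
punchOutOr : ∀ {n} → Fin (suc n) → Fin (suc n) → Fin n → Fin n
punchOutOr j x d with j Fin.≟ x
... | yes _   = d
... | no j≢x  = punchOut j≢x

punchOutOr-≢ : ∀ {n} {j x : Fin (suc n)} d (j≢x : j ≢ x) → punchOutOr j x d ≡ punchOut j≢x
punchOutOr-≢ {j = j} {x} d j≢x with j Fin.≟ x
... | yes j≡x  = ⊥-elim (j≢x j≡x)
... | no  j≢x′ = Fin.punchOut-cong j ≡.refl

-- A permutation of Fin (suc n) is its value at 0 together with a permutation of Fin n.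
insertion : ∀ n → Correspondence (×-decSetoid (Fin.≡-decSetoid (suc n)) (Endo n)) (Endo (suc n))
                                  (λ jα → true ∧ isPerm (proj₂ jα)) isPerm
insertion n = record
  { to          = insert
  ; from        = split
  ; to-cong     = λ { (≡.refl , α≗β) → λ { Fin.zero → ≡.refl ; (Fin.suc p) → ≡.cong (punchIn _) (α≗β p) } }
  ; from-cong   = λ σ≗τ → σ≗τ Fin.zero , λ p → ≡.cong₂ (λ j x → punchOutOr j x p) (σ≗τ Fin.zero) (σ≗τ (Fin.suc p))
  ; to-closed   = λ {jα} h → injective⇒isPerm (insert jα) (insert-injective jα (isPerm⇒injective _ h))
  ; from-closed = λ {σ} h → injective⇒isPerm (proj₂ (split σ)) (split-injective σ (isPerm⇒injective σ h))
  ; from∘to     = λ {jα} _ → ≡.refl , split-insert jα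
  ; to∘from     = λ {σ} h → insert-split σ (isPerm⇒injective σ h)
  }
  where
  insert : Fin (suc n) × (Fin n → Fin n) → Fin (suc n) → Fin (suc n)
  insert (j , α) = j Vector.∷ (punchIn j ∘ α)

  split : (Fin (suc n) → Fin (suc n)) → Fin (suc n) × (Fin n → Fin n)
  split σ = σ Fin.zero , λ p → punchOutOr (σ Fin.zero) (σ (Fin.suc p)) p

  insert-injective : ∀ jα → Injective _≡_ _≡_ (proj₂ jα) → Injective _≡_ _≡_ (insert jα)
  insert-injective (j , α) α-inj {Fin.zero}  {Fin.zero}  _ = ≡.refl
  insert-injective (j , α) α-inj {Fin.zero}  {Fin.suc b} e = ⊥-elim (Fin.punchInᵢ≢i j (α b) (≡.sym e))
  insert-injective (j , α) α-inj {Fin.suc a} {Fin.zero}  e = ⊥-elim (Fin.punchInᵢ≢i j (α a) e)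
  insert-injective (j , α) α-inj {Fin.suc a} {Fin.suc b} e = ≡.cong Fin.suc (α-inj (Fin.punchIn-injective j (α a) (α b) e))

  head≢ : ∀ {σ} → Injective _≡_ _≡_ σ → ∀ p → σ Fin.zero ≢ σ (Fin.suc p)
  head≢ σ-inj p e with σ-inj e
  ... | ()

  split-injective : ∀ σ → Injective _≡_ _≡_ σ → Injective _≡_ _≡_ (proj₂ (split σ))
  split-injective σ σ-inj {a} {b} e = Fin.suc-injective (σ-inj (Fin.punchOut-injective (head≢ σ-inj a) (head≢ σ-inj b)
    (≡.trans (≡.sym (punchOutOr-≢ a (head≢ σ-inj a))) (≡.trans e (punchOutOr-≢ b (head≢ σ-inj b))))))

  split-insert : ∀ jα p → proj₂ (split (insert jα)) p ≡ proj₂ jα p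
  split-insert (j , α) p = ≡.trans (punchOutOr-≢ p (Fin.punchInᵢ≢i j (α p) ∘ ≡.sym)) (Fin.punchOut-punchIn j)

  insert-split : ∀ σ → Injective _≡_ _≡_ σ → ∀ q → insert (split σ) q ≡ σ q
  insert-split σ σ-inj Fin.zero    = ≡.refl
  insert-split σ σ-inj (Fin.suc p) = ≡.trans (≡.cong (punchIn (σ Fin.zero)) (punchOutOr-≢ p (head≢ σ-inj p))) (Fin.punchIn-punchOut _)

-- Block permutations of Fin (n * m): block p goes to block α p, permuted inside by τ p

opaque
  blockMap : ∀ {n m} → (Fin n → Fin n) → (Fin n → Fin m → Fin m) → Fin (n ℕ.* m) → Fin (n ℕ.* m)
  blockMap {n} {m} α τ i = uncurry (λ p r → combine (α p) (τ p r)) (remQuot {n} m i)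

  blockMap-combine : ∀ {n m} (α : Fin n → Fin n) (τ : Fin n → Fin m → Fin m) p r →
                     blockMap α τ (combine p r) ≡ combine (α p) (τ p r)
  blockMap-combine α τ p r = ≡.cong (uncurry (λ p r → combine (α p) (τ p r))) (Fin.remQuot-combine p r)

module _ {n m : ℕ} where

  combine-ext : ∀ {a} {X : Set a} {f g : Fin (n ℕ.* m) → X} →
                (∀ p r → f (combine p r) ≡ g (combine p r)) → ∀ i → f i ≡ g i
  combine-ext {f = f} {g} f≗g i = ≡.subst (λ j → f j ≡ g j) (Fin.combine-remQuot {n} m i) (uncurry f≗g (remQuot {n} m i))

  combine-injective : ∀ {p q : Fin n} {r s : Fin m} → combine p r ≡ combine q s → p ≡ q × r ≡ s
  combine-injective {p} {q} {r} {s} = Fin.combine-injective p r q s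

  blockMap-injective : ∀ {α τ} → Injective _≡_ _≡_ α → (∀ p → Injective _≡_ _≡_ (τ p)) → Injective _≡_ _≡_ (blockMap α τ)
  blockMap-injective {α} {τ} α-inj τ-inj {i} {j} e = begin
    i                                                     ≡⟨ Fin.combine-remQuot {n} m i ⟨
    combine (proj₁ (remQuot {n} m i)) (proj₂ (remQuot {n} m i)) ≡⟨ ≡.cong₂ combine p≡q r≡s ⟩
    combine (proj₁ (remQuot {n} m j)) (proj₂ (remQuot {n} m j)) ≡⟨ Fin.combine-remQuot {n} m j ⟩
    j                                                     ∎
    where
    open ≡.≡-Reasoning
    image : ∀ i → blockMap α τ i ≡ combine (α (proj₁ (remQuot {n} m i))) (τ (proj₁ (remQuot {n} m i)) (proj₂ (remQuot {n} m i)))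
    image i = ≡.trans (≡.cong (blockMap α τ) (≡.sym (Fin.combine-remQuot {n} m i))) (blockMap-combine α τ _ _)
    blocks = combine-injective (≡.trans (≡.sym (image i)) (≡.trans e (image j)))
    p≡q = α-inj (proj₁ blocks)
    cancel : ∀ {p q r s} → p ≡ q → τ p r ≡ τ q s → r ≡ s
    cancel ≡.refl = τ-inj _
    r≡s = cancel p≡q (proj₂ blocks)

module Inversions where
  open ListSum ℕ.+-*-commutativeSemiring
  open import Data.Nat using (_+_; _*_)
  open ≡.≡-Reasoning

  ∑∑ : ∀ {m} → (Fin m → Fin m → ℕ) → ℕ
  ∑∑ {m} F = ∑[ a < m ] ∑[ b < m ] F a b

  module _ {m : ℕ} where

    ∑∑-cong : {F G : Fin m → Fin m → ℕ} → (∀ a b → F a b ≡ G a b) → ∑∑ F ≡ ∑∑ G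
    ∑∑-cong F≗G = sum-cong-≋ {m} (λ a → sum-cong-≋ {m} (F≗G a))

    ∑∑-distrib-+ : (F G : Fin m → Fin m → ℕ) → ∑∑ (λ a b → F a b + G a b) ≡ ∑∑ F + ∑∑ G
    ∑∑-distrib-+ F G = ≡.trans (sum-cong-≋ {m} (λ a → ∑-distrib-+ (F a) (G a)))
      (∑-distrib-+ (λ a → ∑[ b < m ] F a b) (λ a → ∑[ b < m ] G a b))

    ∑∑-*ˡ : ∀ c (F : Fin m → Fin m → ℕ) → ∑∑ (λ a b → c * F a b) ≡ c * ∑∑ F
    ∑∑-*ˡ c F = ≡.sym (≡.trans (*-distribˡ-sum c (λ a → ∑[ b < m ] F a b)) (sum-cong-≋ {m} (λ a → *-distribˡ-sum c (F a))))

    ∑∑-transpose : (F : Fin m → Fin m → ℕ) → ∑∑ (λ a b → F b a) ≡ ∑∑ F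
    ∑∑-transpose F = ∑-comm (λ a b → F b a)

    ∑∑-permute : {g : Fin m → Fin m} → Injective _≡_ _≡_ g → (F : Fin m → Fin m → ℕ) →
                 ∑∑ (λ a b → F (g a) (g b)) ≡ ∑∑ F
    ∑∑-permute g-inj F = ≡.sym (≡.trans (∑-permute _ π) (sum-cong-≋ {m} (λ a → ∑-permute (F (π ⟨$⟩ʳ a)) π)))
      where π = toPermutation g-inj

  inversionSum : ∀ {m} → (Fin m → Fin m) → ℕ
  inversionSum σ = ∑∑ (λ a b → 𝟙 (a <F b ∧ σ b <F σ a))

  length-filterᵇ : ∀ {X : Set} (p : X → Bool) xs → length (filterᵇ p xs) ≡ ∑ₗ xs (𝟙 ∘ p)
  length-filterᵇ p []       = ≡.refl
  length-filterᵇ p (x ∷ xs) with p x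
  ... | true  = ≡.cong suc (length-filterᵇ p xs)
  ... | false = length-filterᵇ p xs

  inversions≡inversionSum : ∀ {m} (σ : Fin m → Fin m) → inversions σ ≡ inversionSum σ
  inversions≡inversionSum {m} σ = begin
    inversions σ                                                         ≡⟨ length-filterᵇ _ (pairs m) ⟩
    ∑ₗ (pairs m) _                                                       ≡⟨ ∑ₗ-cartesianProduct (allFin m) (allFin m) _ ⟩
    ∑[ a ∈ allFin m ] ∑[ b ∈ allFin m ] 𝟙 (a <F b ∧ σ b <F σ a)          ≡⟨ ∑ₗ-cong (allFin m) (λ a → ∑ₗ-allFin (λ b → 𝟙 (a <F b ∧ σ b <F σ a))) ⟩
    ∑[ a ∈ allFin m ] ∑[ b < m ] 𝟙 (a <F b ∧ σ b <F σ a)                 ≡⟨ ∑ₗ-allFin (λ a → ∑[ b < m ] 𝟙 (a <F b ∧ σ b <F σ a)) ⟩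
    inversionSum σ                                                       ∎

  inversionSum-cong : ∀ {m} {σ τ : Fin m → Fin m} → (∀ x → σ x ≡ τ x) → inversionSum σ ≡ inversionSum τ
  inversionSum-cong σ≗τ = ∑∑-cong (λ a b → ≡.cong₂ (λ u v → 𝟙 (a <F b ∧ u <F v)) (σ≗τ b) (σ≗τ a))

  <F-irrefl : ∀ {m} (a : Fin m) → a <F a ≡ false
  <F-irrefl a = ≮⇒<ᵇ {toℕ a} (ℕ.<-irrefl ≡.refl)

  <F-flip : ∀ {m} {a b : Fin m} → a ≢ b → b <F a ≡ not (a <F b)
  <F-flip {a = a} {b} a≢b with Fin.<-cmp a b
  ... | tri< a<b _ _ = ≡.trans (≮⇒<ᵇ (ℕ.<⇒≯ a<b)) (≡.cong not (≡.sym (<⇒<ᵇ a<b)))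
  ... | tri≈ _ a≡b _ = ⊥-elim (a≢b a≡b)
  ... | tri> _ _ b<a = ≡.trans (<⇒<ᵇ b<a) (≡.cong not (≡.sym (≮⇒<ᵇ (ℕ.<⇒≯ b<a))))

  <F⇒≢ : ∀ {m} {a b : Fin m} → a <F b ≡ true → a ≢ b
  <F⇒≢ {a = a} a<b ≡.refl = ℕ.<-irrefl ≡.refl (<ᵇ⇒< {toℕ a} {toℕ a} a<b)

  ∑∑-upper-twice : ∀ {m} (h : Fin m → Fin m → ℕ) → (∀ a b → h a b ≡ h b a) → (∀ a → h a a ≡ 0) →
                   ∑∑ h ≡ ∑∑ (λ a b → 𝟙 (a <F b) * h a b) + ∑∑ (λ a b → 𝟙 (a <F b) * h a b)
  ∑∑-upper-twice h h-sym h-diag = begin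
    ∑∑ h                                            ≡⟨ ∑∑-cong split ⟩
    ∑∑ (λ a b → upper a b + upper b a)              ≡⟨ ∑∑-distrib-+ upper (λ a b → upper b a) ⟩
    ∑∑ upper + ∑∑ (λ a b → upper b a)               ≡⟨ ≡.cong (∑∑ upper +_) (∑∑-transpose upper) ⟩
    ∑∑ upper + ∑∑ upper                             ∎
    where
    upper = λ a b → 𝟙 (a <F b) * h a b
    split : ∀ a b → h a b ≡ upper a b + upper b a
    split a b with a Fin.≟ b
    ... | yes ≡.refl rewrite <F-irrefl a | h-diag a = ≡.refl
    ... | no a≢b rewrite <F-flip a≢b | h-sym b a with a <F b
    ...   | true  = ≡.sym (≡.trans (ℕ.+-identityʳ _) (ℕ.*-identityˡ _))
    ...   | false = ≡.sym (ℕ.*-identityˡ _)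

  n+n≡m+m⇒n≡m : ∀ {n m} → n + n ≡ m + m → n ≡ m
  n+n≡m+m⇒n≡m {n} {m} e with ℕ.<-cmp n m
  ... | tri< n<m _ _ = ⊥-elim (ℕ.<-irrefl e (ℕ.+-mono-< n<m n<m))
  ... | tri≈ _ n≡m _ = n≡m
  ... | tri> _ _ m<n = ⊥-elim (ℕ.<-irrefl (≡.sym e) (ℕ.+-mono-< m<n m<n))

  -- For p = [x < y] and q = [f y < f x] with x ≢ y (so that [y < x] = not p and [f x < f y] = not q).
  pair-parity : ∀ p q → 𝟙 (not p) + 𝟙 q ≡ (𝟙 (p ∧ q) + 𝟙 (not p ∧ not q)) + 2 * 𝟙 (not p ∧ q)
  pair-parity true  true  = ≡.refl
  pair-parity true  false = ≡.refl
  pair-parity false true  = ≡.refl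
  pair-parity false false = ≡.refl

  -- A pair a < b inverted by exactly one of g and f ∘ g is a pair {g a, g b} inverted by f;
  -- counting over all ordered pairs shows there are inversionSum f of them.
  module Composition {m} {f g : Fin m → Fin m} (f-inj : Injective _≡_ _≡_ f) (g-inj : Injective _≡_ _≡_ g) where

    crossed : Fin m → Fin m → ℕ
    crossed x y = 𝟙 (x <F y ∧ f y <F f x) + 𝟙 (y <F x ∧ f x <F f y)

    bothInverted : ℕ
    bothInverted = ∑∑ (λ a b → 𝟙 (a <F b ∧ (g b <F g a ∧ f (g b) <F f (g a))))

    upperCrossings : ℕ
    upperCrossings = ∑∑ (λ a b → 𝟙 (a <F b) * crossed (g a) (g b))

    count-distinct : ∀ {x y} → x ≢ y → 𝟙 (y <F x) + 𝟙 (f y <F f x) ≡ 1 * crossed x y + 2 * 𝟙 (y <F x ∧ f y <F f x)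
    count-distinct {x} {y} x≢y = begin
      𝟙 (y <F x) + 𝟙 q                                   ≡⟨ ≡.cong (λ u → 𝟙 u + 𝟙 q) y<x ⟩
      𝟙 (not p) + 𝟙 q                                    ≡⟨ pair-parity p q ⟩
      (𝟙 (p ∧ q) + 𝟙 (not p ∧ not q)) + 2 * 𝟙 (not p ∧ q) ≡⟨ ≡.cong₂ (λ u v → (𝟙 (p ∧ q) + 𝟙 (u ∧ v)) + 2 * 𝟙 (u ∧ q)) (≡.sym y<x) (≡.sym fx<fy) ⟩
      crossed x y + 2 * 𝟙 (y <F x ∧ q)                   ≡⟨ ≡.cong (_+ 2 * 𝟙 (y <F x ∧ q)) (ℕ.*-identityˡ (crossed x y)) ⟨
      1 * crossed x y + 2 * 𝟙 (y <F x ∧ q)               ∎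
      where
      p = x <F y
      q = f y <F f x
      y<x = <F-flip x≢y
      fx<fy = <F-flip (x≢y ∘ f-inj ∘ ≡.sym)

    count-pair : ∀ a b → 𝟙 (a <F b ∧ g b <F g a) + 𝟙 (a <F b ∧ f (g b) <F f (g a))
                       ≡ 𝟙 (a <F b) * crossed (g a) (g b) + 2 * 𝟙 (a <F b ∧ (g b <F g a ∧ f (g b) <F f (g a)))
    count-pair a b with a <F b in a<b
    ... | false = ≡.refl
    ... | true  = count-distinct (<F⇒≢ a<b ∘ g-inj)

    sum-split : inversionSum g + inversionSum (f ∘ g) ≡ upperCrossings + 2 * bothInverted
    sum-split = begin
      inversionSum g + inversionSum (f ∘ g)                   ≡⟨ ∑∑-distrib-+ invᵍ invᶠᵍ ⟨
      ∑∑ (λ a b → invᵍ a b + invᶠᵍ a b)                       ≡⟨ ∑∑-cong count-pair ⟩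
      ∑∑ (λ a b → crossedᵍ a b + 2 * both a b)                ≡⟨ ∑∑-distrib-+ crossedᵍ (λ a b → 2 * both a b) ⟩
      upperCrossings + ∑∑ (λ a b → 2 * both a b)              ≡⟨ ≡.cong (upperCrossings +_) (∑∑-*ˡ 2 both) ⟩
      upperCrossings + 2 * bothInverted                       ∎
      where
      invᵍ   = λ a b → 𝟙 (a <F b ∧ g b <F g a)
      invᶠᵍ  = λ a b → 𝟙 (a <F b ∧ f (g b) <F f (g a))
      crossedᵍ = λ a b → 𝟙 (a <F b) * crossed (g a) (g b)
      both   = λ a b → 𝟙 (a <F b ∧ (g b <F g a ∧ f (g b) <F f (g a)))

    ∑∑-crossed : ∑∑ crossed ≡ inversionSum f + inversionSum f
    ∑∑-crossed = ≡.trans (∑∑-distrib-+ invᶠ (λ x y → invᶠ y x)) (≡.cong (inversionSum f +_) (∑∑-transpose invᶠ))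
      where invᶠ = λ x y → 𝟙 (x <F y ∧ f y <F f x)

    crossed-sym : ∀ x y → crossed x y ≡ crossed y x
    crossed-sym x y = ℕ.+-comm (𝟙 (x <F y ∧ f y <F f x)) _

    crossed-diag : ∀ x → crossed x x ≡ 0
    crossed-diag x rewrite <F-irrefl x = ≡.refl

    upperCrossings≡inversionSum : upperCrossings ≡ inversionSum f
    upperCrossings≡inversionSum = n+n≡m+m⇒n≡m (begin
      upperCrossings + upperCrossings    ≡⟨ ∑∑-upper-twice (λ a b → crossed (g a) (g b)) (λ a b → crossed-sym (g a) (g b)) (crossed-diag ∘ g) ⟨
      ∑∑ (λ a b → crossed (g a) (g b))   ≡⟨ ∑∑-permute g-inj crossed ⟩
      ∑∑ crossed                         ≡⟨ ∑∑-crossed ⟩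
      inversionSum f + inversionSum f    ∎)

  inversionSum-∘ : ∀ {m} {f g : Fin m → Fin m} → Injective _≡_ _≡_ f → Injective _≡_ _≡_ g →
                   ∃ λ c → inversionSum g + inversionSum (f ∘ g) ≡ inversionSum f + 2 * c
  inversionSum-∘ f-inj g-inj = bothInverted , ≡.trans sum-split (≡.cong (_+ 2 * bothInverted) upperCrossings≡inversionSum)
    where open Composition f-inj g-inj

  combine-<F-≡ : ∀ {n m} (p : Fin n) (r s : Fin m) → combine p r <F combine p s ≡ r <F s
  combine-<F-≡ {m = m} p r s = ⇔→≡ {z = true} (mk⇔
    (λ h → <⇒<ᵇ (ℕ.+-cancelˡ-< (m * toℕ p) _ _ (≡.subst₂ ℕ._<_ (Fin.toℕ-combine p r) (Fin.toℕ-combine p s) (<ᵇ⇒< h))))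
    (λ h → <⇒<ᵇ (≡.subst₂ ℕ._<_ (≡.sym (Fin.toℕ-combine p r)) (≡.sym (Fin.toℕ-combine p s)) (ℕ.+-monoʳ-< (m * toℕ p) (<ᵇ⇒< h)))))

  combine-<F-≢ : ∀ {n m} {p q : Fin n} (r s : Fin m) → p ≢ q → combine p r <F combine q s ≡ p <F q
  combine-<F-≢ {p = p} {q} r s p≢q with Fin.<-cmp p q
  ... | tri< p<q _ _ = ≡.trans (<⇒<ᵇ (Fin.combine-monoˡ-< r s p<q)) (≡.sym (<⇒<ᵇ p<q))
  ... | tri≈ _ p≡q _ = ⊥-elim (p≢q p≡q)
  ... | tri> _ _ q<p = ≡.trans (≮⇒<ᵇ (ℕ.<⇒≯ (Fin.combine-monoˡ-< s r q<p))) (≡.sym (≮⇒<ᵇ (ℕ.<⇒≯ q<p)))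

  ∑-const : ∀ m c → ∑[ i < m ] c ≡ m * c
  ∑-const zero    c = ≡.refl
  ∑-const (suc m) c = ≡.cong (c +_) (∑-const m c)

  module BlockInversions {n m} (α : Fin n → Fin n) (τ : Fin n → Fin m → Fin m) (α-inj : Injective _≡_ _≡_ α) where

    β = blockMap α τ

    pairTerm : Fin (n * m) → Fin (n * m) → ℕ
    pairTerm i j = 𝟙 (i <F j ∧ β j <F β i)

    blockTerm : Fin n → Fin n → ℕ
    blockTerm p q = 𝟙 (p <F q ∧ α q <F α p)

    block-pair : ∀ p q → ∑[ r < m ] ∑[ s < m ] pairTerm (combine p r) (combine q s)
                         ≡ m * m * blockTerm p q + 𝟙 (does (q Fin.≟ p)) * inversionSum (τ q)
    block-pair p q with q Fin.≟ p
    ... | yes ≡.refl = begin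
      ∑[ r < m ] ∑[ s < m ] pairTerm (combine p r) (combine p s)  ≡⟨ ∑∑-cong same-block ⟩
      inversionSum (τ p)                                          ≡⟨ ℕ.+-identityʳ _ ⟨
      0 + 1 * inversionSum (τ p)                                  ≡⟨ ≡.cong (_+ 1 * inversionSum (τ p)) (ℕ.*-zeroʳ (m * m)) ⟨
      m * m * 0 + 1 * inversionSum (τ p)
        ≡⟨ ≡.cong (λ b → m * m * 𝟙 (b ∧ α p <F α p) + 1 * inversionSum (τ p)) (<F-irrefl p) ⟨
      m * m * blockTerm p p + 1 * inversionSum (τ p)              ∎
      where
      same-block : ∀ r s → pairTerm (combine p r) (combine p s) ≡ 𝟙 (r <F s ∧ τ p s <F τ p r)
      same-block r s = ≡.cong₂ (λ u v → 𝟙 (u ∧ v)) (combine-<F-≡ p r s)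
        (≡.trans (≡.cong₂ _<F_ (blockMap-combine α τ p s) (blockMap-combine α τ p r)) (combine-<F-≡ (α p) (τ p s) (τ p r)))
    ... | no q≢p = begin
      ∑[ r < m ] ∑[ s < m ] pairTerm (combine p r) (combine q s)  ≡⟨ ∑∑-cong other-block ⟩
      ∑[ r < m ] ∑[ s < m ] blockTerm p q                         ≡⟨ sum-cong-≋ {m} (λ _ → ∑-const m (blockTerm p q)) ⟩
      ∑[ r < m ] (m * blockTerm p q)                              ≡⟨ ∑-const m (m * blockTerm p q) ⟩
      m * (m * blockTerm p q)                                     ≡⟨ ℕ.*-assoc m m _ ⟨
      m * m * blockTerm p q                                       ≡⟨ ℕ.+-identityʳ _ ⟨
      m * m * blockTerm p q + 0 * inversionSum (τ q)              ∎
      where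
      other-block : ∀ r s → pairTerm (combine p r) (combine q s) ≡ blockTerm p q
      other-block r s = ≡.cong₂ (λ u v → 𝟙 (u ∧ v)) (combine-<F-≢ r s (q≢p ∘ ≡.sym))
        (≡.trans (≡.cong₂ _<F_ (blockMap-combine α τ q s) (blockMap-combine α τ p r)) (combine-<F-≢ (τ q s) (τ p r) (q≢p ∘ α-inj)))

    inversionSum-blockMap : inversionSum β ≡ m * m * inversionSum α + ∑[ p < n ] inversionSum (τ p)
    inversionSum-blockMap = begin
      inversionSum β
        ≡⟨ ∑-combine n m (λ i → ∑[ j < n * m ] pairTerm i j) ⟩
      ∑[ p < n ] ∑[ r < m ] ∑[ j < n * m ] pairTerm (combine p r) j
        ≡⟨ sum-cong-≋ {n} (λ p → sum-cong-≋ {m} (λ r → ∑-combine n m (pairTerm (combine p r)))) ⟩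
      ∑[ p < n ] ∑[ r < m ] ∑[ q < n ] ∑[ s < m ] pairTerm (combine p r) (combine q s)
        ≡⟨ sum-cong-≋ {n} (λ p → ∑-comm {m} {n} (λ r q → ∑[ s < m ] pairTerm (combine p r) (combine q s))) ⟩
      ∑[ p < n ] ∑[ q < n ] ∑[ r < m ] ∑[ s < m ] pairTerm (combine p r) (combine q s)
        ≡⟨ ∑∑-cong block-pair ⟩
      ∑∑ (λ p q → m * m * blockTerm p q + 𝟙 (does (q Fin.≟ p)) * inversionSum (τ q))
        ≡⟨ ∑∑-distrib-+ (λ p q → m * m * blockTerm p q) (λ p q → 𝟙 (does (q Fin.≟ p)) * inversionSum (τ q)) ⟩
      ∑∑ (λ p q → m * m * blockTerm p q) + ∑[ p < n ] ∑[ q < n ] (𝟙 (does (q Fin.≟ p)) * inversionSum (τ q))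
        ≡⟨ ≡.cong₂ _+_ (∑∑-*ˡ {n} (m * m) blockTerm) (sum-cong-≋ {n} (λ p → ∑-select p (inversionSum ∘ τ))) ⟩
      m * m * inversionSum α + ∑[ p < n ] inversionSum (τ p) ∎

  open BlockInversions using (inversionSum-blockMap) public

module Sign {c ℓ} (R : CommutativeRing c ℓ) where
  open CommutativeRing R
  open import Algebra.Properties.Ring ring using (-‿distribˡ-*; -‿involutive)
  open import Relation.Binary.Reasoning.Setoid setoid
  open ListSum commutativeSemiring using (∏; product-cong)
  open Inversions
  open ListSum ℕ.+-*-commutativeSemiring using (sum-syntax)

  parity : ℕ → Carrier
  parity k = if even? k then 1# else - 1#

  sign : ∀ {m} → (Fin m → Fin m) → Carrier
  sign σ = parity (inversions σ)

  parity-suc : ∀ k → parity (suc k) ≈ - parity k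
  parity-suc k with even? k
  ... | true  = refl
  ... | false = sym (-‿involutive 1#)

  parity-+ : ∀ a b → parity (a ℕ.+ b) ≈ parity a * parity b
  parity-+ zero    b = sym (*-identityˡ _)
  parity-+ (suc a) b = begin
    parity (suc (a ℕ.+ b))  ≈⟨ parity-suc (a ℕ.+ b) ⟩
    - parity (a ℕ.+ b)      ≈⟨ -‿cong (parity-+ a b) ⟩
    - (parity a * parity b) ≈⟨ -‿distribˡ-* _ _ ⟩
    - parity a * parity b   ≈⟨ *-congʳ (parity-suc a) ⟨
    parity (suc a) * parity b ∎

  parity-square : ∀ a → parity a * parity a ≈ 1#
  parity-square a with even? a
  ... | true  = *-identityˡ _
  ... | false = begin
    - 1# * - 1#   ≈⟨ -‿distribˡ-* _ _ ⟨
    - (1# * - 1#) ≈⟨ -‿cong (*-identityˡ _) ⟩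
    - - 1#        ≈⟨ -‿involutive _ ⟩
    1#            ∎

  parity-double : ∀ a → parity (2 ℕ.* a) ≈ 1#
  parity-double a = begin
    parity (a ℕ.+ (a ℕ.+ 0)) ≡⟨ ≡.cong (λ b → parity (a ℕ.+ b)) (ℕ.+-identityʳ a) ⟩
    parity (a ℕ.+ a)         ≈⟨ parity-+ a a ⟩
    parity a * parity a      ≈⟨ parity-square a ⟩
    1#                       ∎

  parity-∑ : ∀ n (f : Fin n → ℕ) → parity (∑[ p < n ] f p) ≈ ∏[ p < n ] parity (f p)
  parity-∑ zero    f = refl
  parity-∑ (suc n) f = trans (parity-+ (f Fin.zero) _) (*-congˡ (parity-∑ n (f ∘ Fin.suc)))

  sign≡parity-inversionSum : ∀ {m} (σ : Fin m → Fin m) → sign σ ≡ parity (inversionSum σ)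
  sign≡parity-inversionSum σ = ≡.cong parity (inversions≡inversionSum σ)

  sign-cong : ∀ {m} {σ τ : Fin m → Fin m} → (∀ x → σ x ≡ τ x) → sign σ ≡ sign τ
  sign-cong {σ = σ} {τ} σ≗τ = ≡.cong parity
    (≡.trans (inversions≡inversionSum σ) (≡.trans (inversionSum-cong σ≗τ) (≡.sym (inversions≡inversionSum τ))))

  sign-∘ : ∀ {m} {f g : Fin m → Fin m} → Injective _≡_ _≡_ f → Injective _≡_ _≡_ g → sign (f ∘ g) ≈ sign f * sign g
  sign-∘ {f = f} {g} f-inj g-inj with c , I[g]+I[fg]≡I[f]+2c ← inversionSum-∘ f-inj g-inj = begin
    sign (f ∘ g)                              ≡⟨ sign≡parity-inversionSum (f ∘ g) ⟩
    parity I[fg]                              ≈⟨ *-identityˡ _ ⟨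
    1# * parity I[fg]                         ≈⟨ *-congʳ (parity-square I[g]) ⟨
    (parity I[g] * parity I[g]) * parity I[fg] ≈⟨ *-assoc _ _ _ ⟩
    parity I[g] * (parity I[g] * parity I[fg]) ≈⟨ *-congˡ (parity-+ I[g] I[fg]) ⟨
    parity I[g] * parity (I[g] ℕ.+ I[fg])      ≡⟨ ≡.cong (λ k → parity I[g] * parity k) I[g]+I[fg]≡I[f]+2c ⟩
    parity I[g] * parity (I[f] ℕ.+ 2 ℕ.* c)    ≈⟨ *-congˡ (parity-+ I[f] (2 ℕ.* c)) ⟩
    parity I[g] * (parity I[f] * parity (2 ℕ.* c)) ≈⟨ *-congˡ (*-congˡ (parity-double c)) ⟩
    parity I[g] * (parity I[f] * 1#)           ≈⟨ *-congˡ (*-identityʳ _) ⟩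
    parity I[g] * parity I[f]                  ≈⟨ *-comm _ _ ⟩
    parity I[f] * parity I[g]                  ≡⟨ ≡.cong₂ _*_ (sign≡parity-inversionSum f) (sign≡parity-inversionSum g) ⟨
    sign f * sign g                            ∎
    where
    I[f] = inversionSum f
    I[g] = inversionSum g
    I[fg] = inversionSum (f ∘ g)

  -- Moving blocks of even size around contributes (2k)² inversions per block inversion: an even number.
  sign-blockMap : ∀ {n} k {α : Fin n → Fin n} (τ : Fin n → Fin (2 ℕ.* k) → Fin (2 ℕ.* k)) → Injective _≡_ _≡_ α →
                  sign (blockMap α τ) ≈ ∏[ p < n ] sign (τ p)
  sign-blockMap {n} k {α} τ α-inj = begin
    sign (blockMap α τ)                                 ≡⟨ sign≡parity-inversionSum (blockMap α τ) ⟩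
    parity (inversionSum (blockMap α τ))                ≡⟨ ≡.cong parity (inversionSum-blockMap α τ α-inj) ⟩
    parity (m ℕ.* m ℕ.* I[α] ℕ.+ ∑[ p < n ] I[τ] p)     ≈⟨ parity-+ (m ℕ.* m ℕ.* I[α]) (∑[ p < n ] I[τ] p) ⟩
    parity (m ℕ.* m ℕ.* I[α]) * parity (∑[ p < n ] I[τ] p) ≡⟨ ≡.cong (λ j → parity j * parity (∑[ p < n ] I[τ] p)) even ⟩
    parity (2 ℕ.* (k ℕ.* (m ℕ.* I[α]))) * parity (∑[ p < n ] I[τ] p) ≈⟨ *-congʳ (parity-double (k ℕ.* (m ℕ.* I[α]))) ⟩
    1# * parity (∑[ p < n ] I[τ] p)                     ≈⟨ *-identityˡ _ ⟩
    parity (∑[ p < n ] I[τ] p)                          ≈⟨ parity-∑ n I[τ] ⟩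
    ∏[ p < n ] parity (I[τ] p)                          ≈⟨ product-cong {n} (λ p → reflexive (≡.sym (sign≡parity-inversionSum (τ p)))) ⟩
    ∏[ p < n ] sign (τ p)                               ∎
    where
    m = 2 ℕ.* k
    I[α] = inversionSum α
    I[τ] = λ p → inversionSum (τ p)
    even : m ℕ.* m ℕ.* I[α] ≡ 2 ℕ.* (k ℕ.* (m ℕ.* I[α]))
    even = ≡.trans (ℕ.*-assoc m m I[α]) (ℕ.*-assoc 2 k (m ℕ.* I[α]))

-- Ranks: sorting the values of an injective function Fin m → ℕ

module Rank where
  open ListSum ℕ.+-*-commutativeSemiring using (𝟙; sum; sum-syntax; sum-cong-≋; sum-replicate-zero; ∑-permute)
  open import Data.Nat using (_+_; _≤_; _<_; z≤n; s≤s)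

  open Inversions using (<F-irrefl)
  open ≡.≡-Reasoning

  𝟙≤1 : ∀ b → 𝟙 b ≤ 1
  𝟙≤1 true  = s≤s z≤n
  𝟙≤1 false = z≤n

  count≤ : ∀ m (P : Fin m → Bool) → ∑[ r < m ] 𝟙 (P r) ≤ m
  count≤ zero    P = z≤n
  count≤ (suc m) P = ℕ.+-mono-≤ (𝟙≤1 (P Fin.zero)) (count≤ m (P ∘ Fin.suc))

  count< : ∀ m (P : Fin m → Bool) r → P r ≡ false → ∑[ r < m ] 𝟙 (P r) < m
  count< (suc m) P Fin.zero    Pr rewrite Pr = s≤s (count≤ m (P ∘ Fin.suc))
  count< (suc m) P (Fin.suc r) Pr = ℕ.+-mono-≤-< (𝟙≤1 (P Fin.zero)) (count< m (P ∘ Fin.suc) r Pr)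

  ∑-mono-≤ : ∀ m {f g : Fin m → ℕ} → (∀ r → f r ≤ g r) → ∑[ r < m ] f r ≤ ∑[ r < m ] g r
  ∑-mono-≤ zero    f≤g = z≤n
  ∑-mono-≤ (suc m) f≤g = ℕ.+-mono-≤ (f≤g Fin.zero) (∑-mono-≤ m (f≤g ∘ Fin.suc))

  ∑-mono-< : ∀ m {f g : Fin m → ℕ} → (∀ r → f r ≤ g r) → ∀ a → f a < g a → ∑[ r < m ] f r < ∑[ r < m ] g r
  ∑-mono-< (suc m) f≤g Fin.zero    fa<ga = ℕ.+-mono-<-≤ fa<ga (∑-mono-≤ m (f≤g ∘ Fin.suc))
  ∑-mono-< (suc m) f≤g (Fin.suc a) fa<ga = ℕ.+-mono-≤-< (f≤g Fin.zero) (∑-mono-< m (f≤g ∘ Fin.suc) a fa<ga)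

  count-<F : ∀ m (t : Fin m) → ∑[ s < m ] 𝟙 (s <F t) ≡ toℕ t
  count-<F (suc m) Fin.zero    = sum-replicate-zero m
  count-<F (suc m) (Fin.suc t) = ≡.cong suc (count-<F m t)

  opaque
    rank : ∀ {m} → (Fin m → ℕ) → Fin m → Fin m
    rank {m} g r = Fin.fromℕ< (count< m (λ s → g s ℕ.<ᵇ g r) r (≮⇒<ᵇ {g r} (ℕ.<-irrefl ≡.refl)))

    toℕ-rank : ∀ {m} (g : Fin m → ℕ) r → toℕ (rank g r) ≡ ∑[ s < m ] 𝟙 (g s ℕ.<ᵇ g r)
    toℕ-rank g r = Fin.toℕ-fromℕ< _

  module _ {m : ℕ} where

    rank-cong : ∀ {g h : Fin m → ℕ} → (∀ r → g r ≡ h r) → ∀ r → rank g r ≡ rank h r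
    rank-cong {g} {h} g≗h r = Fin.toℕ-injective (begin
      toℕ (rank g r)                   ≡⟨ toℕ-rank g r ⟩
      ∑[ s < m ] 𝟙 (g s ℕ.<ᵇ g r)      ≡⟨ sum-cong-≋ {m} (λ s → ≡.cong₂ (λ u v → 𝟙 (u ℕ.<ᵇ v)) (g≗h s) (g≗h r)) ⟩
      ∑[ s < m ] 𝟙 (h s ℕ.<ᵇ h r)      ≡⟨ toℕ-rank h r ⟨
      toℕ (rank h r)                   ∎)

    rank-mono : ∀ (g : Fin m → ℕ) {a b} → g a < g b → rank g a Fin.< rank g b
    rank-mono g {a} {b} ga<gb = ≡.subst₂ _<_ (≡.sym (toℕ-rank g a)) (≡.sym (toℕ-rank g b))
      (∑-mono-< m below a (≡.subst₂ (λ u v → 𝟙 u < 𝟙 v) (≡.sym (≮⇒<ᵇ {g a} (ℕ.<-irrefl ≡.refl))) (≡.sym (<⇒<ᵇ ga<gb)) (s≤s z≤n)))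
      where
      below : ∀ s → 𝟙 (g s ℕ.<ᵇ g a) ≤ 𝟙 (g s ℕ.<ᵇ g b)
      below s with g s ℕ.<ᵇ g a in gs<ga
      ... | false = z≤n
      ... | true rewrite <⇒<ᵇ (ℕ.<-trans (<ᵇ⇒< gs<ga) ga<gb) = s≤s z≤n

    rank-injective : ∀ {g : Fin m → ℕ} → Injective _≡_ _≡_ g → Injective _≡_ _≡_ (rank g)
    rank-injective {g} g-inj {a} {b} e with ℕ.<-cmp (g a) (g b)
    ... | tri< ga<gb _ _ = ⊥-elim (Fin.<-irrefl e (rank-mono g ga<gb))
    ... | tri≈ _ ga≡gb _ = g-inj ga≡gb
    ... | tri> _ _ gb<ga = ⊥-elim (Fin.<-irrefl (≡.sym e) (rank-mono g gb<ga))

    rank-<F : ∀ {g : Fin m → ℕ} → Injective _≡_ _≡_ g → ∀ a b → rank g a <F rank g b ≡ (g a ℕ.<ᵇ g b)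
    rank-<F {g} g-inj a b = ⇔→≡ {z = true} (mk⇔ (<⇒<ᵇ ∘ reflect ∘ <ᵇ⇒<) (<⇒<ᵇ ∘ rank-mono g ∘ <ᵇ⇒<))
      where
      reflect : rank g a Fin.< rank g b → g a < g b
      reflect ra<rb with ℕ.<-cmp (g a) (g b)
      ... | tri< ga<gb _ _ = ga<gb
      ... | tri≈ _ ga≡gb _ = ⊥-elim (Fin.<-irrefl (≡.cong (rank g) (g-inj ga≡gb)) ra<rb)
      ... | tri> _ _ gb<ga = ⊥-elim (Fin.<-asym ra<rb (rank-mono g gb<ga))

    rank-sorted : ∀ {h : Fin m → ℕ} → h Preserves Fin._<_ ⟶ _<_ → ∀ {τ} → Injective _≡_ _≡_ τ → ∀ r → rank (h ∘ τ) r ≡ τ r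
    rank-sorted {h} h-mono {τ} τ-inj r = Fin.toℕ-injective (begin
      toℕ (rank (h ∘ τ) r)                    ≡⟨ toℕ-rank (h ∘ τ) r ⟩
      ∑[ s < m ] 𝟙 (h (τ s) ℕ.<ᵇ h (τ r))     ≡⟨ sum-cong-≋ {m} (λ s → ≡.cong 𝟙 (order-reflecting (τ s) (τ r))) ⟩
      ∑[ s < m ] 𝟙 (τ s <F τ r)               ≡⟨ ∑-permute (λ t → 𝟙 (t <F τ r)) (toPermutation τ-inj) ⟨
      ∑[ t < m ] 𝟙 (t <F τ r)                 ≡⟨ count-<F m (τ r) ⟩
      toℕ (τ r)                               ∎)
      where
      order-reflecting : ∀ a b → (h a ℕ.<ᵇ h b) ≡ (a <F b)
      order-reflecting a b = ⇔→≡ {z = true} (mk⇔ (<⇒<ᵇ ∘ reflect ∘ <ᵇ⇒<) (<⇒<ᵇ ∘ h-mono ∘ <ᵇ⇒<))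
        where
        reflect : h a < h b → a Fin.< b
        reflect ha<hb with Fin.<-cmp a b
        ... | tri< a<b _ _ = a<b
        ... | tri≈ _ a≡b _ = ⊥-elim (ℕ.<-irrefl (≡.cong h a≡b) ha<hb)
        ... | tri> _ _ b<a = ⊥-elim (ℕ.<-asym ha<hb (h-mono b<a))

-- Every permutation of Fin (n * m) is uniquely a block-sorted permutation
-- composed with a permutation of the blocks and permutations inside them

-- Blocks are nonempty (m = suc m′), so that each block has a first entry.
module BlockDecomposition (n m′ : ℕ) where
  open Rank using (rank; rank-cong; rank-injective; rank-<F; rank-sorted)
  open import Data.Nat using (_<_)
  open ≡.≡-Reasoning

  m N : ℕ
  m = suc m′
  N = n ℕ.* m

  record Sorted (σ : Fin N → Fin N) : Set where
    field
      within : ∀ (p : Fin n) {r s : Fin m} → r Fin.< s → σ (combine p r) Fin.< σ (combine p s)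
      across : ∀ {p q : Fin n} → p Fin.< q → σ (combine p Fin.zero) Fin.< σ (combine q Fin.zero)

  Sorted-cong : ∀ {σ σ₁} → (∀ i → σ i ≡ σ₁ i) → Sorted σ → Sorted σ₁
  Sorted-cong σ≗σ₁ sorted = record
    { within = λ p r<s → ≡.subst₂ Fin._<_ (σ≗σ₁ _) (σ≗σ₁ _) (Sorted.within sorted p r<s)
    ; across = λ p<q → ≡.subst₂ Fin._<_ (σ≗σ₁ _) (σ≗σ₁ _) (Sorted.across sorted p<q)
    }

  Triple : Set
  Triple = (Fin N → Fin N) × (Fin n → Fin n) × (Fin n → Fin m → Fin m)

  assemble : Triple → Fin N → Fin N
  assemble (σ , α , τ) = σ ∘ blockMap (inverse α) (τ ∘ inverse α)

  assemble-combine : ∀ σ α τ q r → assemble (σ , α , τ) (combine q r) ≡ σ (combine (inverse α q) (τ (inverse α q) r))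
  assemble-combine σ α τ q r = ≡.cong σ (blockMap-combine {n} {m} (inverse α) (τ ∘ inverse α) q r)

  inBlockRank : (Fin N → Fin N) → Fin n → Fin m → Fin m
  inBlockRank π q = rank (λ r → toℕ (π (combine q r)))

  -- the smallest entry of block q: the one of in-block rank 0
  blockLead : (Fin N → Fin N) → Fin n → ℕ
  blockLead π q = toℕ (π (combine q (inverse (inBlockRank π q) Fin.zero)))

  blockOrder : (Fin N → Fin N) → Fin n → Fin n
  blockOrder π = inverse (rank (blockLead π))

  decompose : (Fin N → Fin N) → Triple
  decompose π = π ∘ blockMap α (λ p → inverse (τ p)) , α , τ
    where
    α = blockOrder π
    τ = λ p → inBlockRank π (α p)

  assemble-injective : ∀ {σ α τ} → Injective _≡_ _≡_ σ → Injective _≡_ _≡_ α → (∀ p → Injective _≡_ _≡_ (τ p)) →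
                       Injective _≡_ _≡_ (assemble (σ , α , τ))
  assemble-injective {σ} {α} {τ} σ-inj α-inj τ-inj =
    blockMap-injective {n} {m} (inverse-injective α-inj) (λ p → τ-inj (inverse α p)) ∘ σ-inj

  module _ {σ : Fin N → Fin N} {α : Fin n → Fin n} {τ : Fin n → Fin m → Fin m}
           (σ-sorted : Sorted σ) (α-inj : Injective _≡_ _≡_ α) (τ-inj : ∀ p → Injective _≡_ _≡_ (τ p)) where
    open Sorted σ-sorted
    private
      π = assemble (σ , α , τ)
      α⁻¹ = inverse α

    inBlockRank-assemble : ∀ q r → inBlockRank π q r ≡ τ (α⁻¹ q) r
    inBlockRank-assemble q r = ≡.trans (rank-cong (λ r → ≡.cong toℕ (assemble-combine σ α τ q r)) r)
                                       (rank-sorted (within (α⁻¹ q)) (τ-inj (α⁻¹ q)) r)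

    blockLead-assemble : ∀ q → blockLead π q ≡ toℕ (σ (combine (α⁻¹ q) Fin.zero))
    blockLead-assemble q = begin
      toℕ (π (combine q (inverse (inBlockRank π q) Fin.zero)))         ≡⟨ ≡.cong toℕ (assemble-combine σ α τ q _) ⟩
      toℕ (σ (combine (α⁻¹ q) (τ (α⁻¹ q) (inverse (inBlockRank π q) Fin.zero))))
        ≡⟨ ≡.cong (λ r → toℕ (σ (combine (α⁻¹ q) (τ (α⁻¹ q) r)))) (inverse-cong (inBlockRank-assemble q) Fin.zero) ⟩
      toℕ (σ (combine (α⁻¹ q) (τ (α⁻¹ q) (inverse (τ (α⁻¹ q)) Fin.zero))))
        ≡⟨ ≡.cong (λ r → toℕ (σ (combine (α⁻¹ q) r))) (inverseʳ (τ-inj (α⁻¹ q)) Fin.zero) ⟩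
      toℕ (σ (combine (α⁻¹ q) Fin.zero))                              ∎

    blockOrder-assemble : ∀ p → blockOrder π p ≡ α p
    blockOrder-assemble p = begin
      inverse (rank (blockLead π)) p
        ≡⟨ inverse-cong (λ q → ≡.trans (rank-cong blockLead-assemble q) (rank-sorted across (inverse-injective α-inj) q)) p ⟩
      inverse α⁻¹ p                  ≡⟨ inverse-involutive α-inj p ⟩
      α p                            ∎

    inBlockRank-blockOrder : ∀ p r → inBlockRank π (blockOrder π p) r ≡ τ p r
    inBlockRank-blockOrder p r = begin
      inBlockRank π (blockOrder π p) r ≡⟨ ≡.cong (λ q → inBlockRank π q r) (blockOrder-assemble p) ⟩
      inBlockRank π (α p) r            ≡⟨ inBlockRank-assemble (α p) r ⟩
      τ (α⁻¹ (α p)) r                  ≡⟨ ≡.cong (λ q → τ q r) (inverseˡ α-inj p) ⟩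
      τ p r                            ∎

    decompose-assemble₁ : ∀ i → proj₁ (decompose π) i ≡ σ i
    decompose-assemble₁ = combine-ext λ p s → begin
      π (blockMap α′ (λ p → inverse (τ′ p)) (combine p s)) ≡⟨ ≡.cong π (blockMap-combine α′ (λ p → inverse (τ′ p)) p s) ⟩
      π (combine (α′ p) (inverse (τ′ p) s))
        ≡⟨ ≡.cong₂ (λ q r → π (combine q r)) (blockOrder-assemble p) (inverse-cong (inBlockRank-blockOrder p) s) ⟩
      π (combine (α p) (inverse (τ p) s))                  ≡⟨ assemble-combine σ α τ (α p) _ ⟩
      σ (combine (α⁻¹ (α p)) (τ (α⁻¹ (α p)) (inverse (τ p) s))) ≡⟨ ≡.cong (λ q → σ (combine q (τ q (inverse (τ p) s)))) (inverseˡ α-inj p) ⟩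
      σ (combine p (τ p (inverse (τ p) s)))                ≡⟨ ≡.cong (σ ∘ combine p) (inverseʳ (τ-inj p) s) ⟩
      σ (combine p s)                                      ∎
      where
      α′ = blockOrder π
      τ′ = λ p → inBlockRank π (α′ p)

  module _ {π : Fin N → Fin N} (π-inj : Injective _≡_ _≡_ π) where
    private
      α = blockOrder π
      τ = λ p → inBlockRank π (α p)
      σ = proj₁ (decompose π)

    toℕ∘π-injective : Injective _≡_ _≡_ (toℕ ∘ π)
    toℕ∘π-injective = π-inj ∘ Fin.toℕ-injective

    inBlockValues-injective : ∀ (q : Fin n) → Injective _≡_ _≡_ (λ (r : Fin m) → toℕ (π (combine q r)))
    inBlockValues-injective q = proj₂ ∘ combine-injective {n} {m} ∘ toℕ∘π-injective

    inBlockRank-injective : ∀ (q : Fin n) → Injective _≡_ _≡_ (inBlockRank π q)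
    inBlockRank-injective q = rank-injective (inBlockValues-injective q)

    blockLead-injective : Injective _≡_ _≡_ (blockLead π)
    blockLead-injective = proj₁ ∘ combine-injective {n} {m} ∘ toℕ∘π-injective

    blockOrder-injective : Injective _≡_ _≡_ α
    blockOrder-injective = inverse-injective (rank-injective blockLead-injective)

    decompose-injective : Injective _≡_ _≡_ σ
    decompose-injective = blockMap-injective blockOrder-injective (λ p → inverse-injective (inBlockRank-injective (α p))) ∘ π-inj

    σ-combine : ∀ p s → σ (combine p s) ≡ π (combine (α p) (inverse (τ p) s))
    σ-combine p s = ≡.cong π (blockMap-combine α (λ p → inverse (τ p)) p s)

    decompose-sorted : Sorted σ
    decompose-sorted = record { within = within ; across = across }
      where
      within : ∀ p {r s : Fin m} → r Fin.< s → σ (combine p r) Fin.< σ (combine p s)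
      within p {r} {s} r<s = ≡.subst₂ _<_ (≡.cong toℕ (≡.sym (σ-combine p r))) (≡.cong toℕ (≡.sym (σ-combine p s)))
        (<ᵇ⇒< (≡.trans (≡.sym (rank-<F (inBlockValues-injective (α p)) (inverse (τ p) r) (inverse (τ p) s)))
                       (≡.trans (≡.cong₂ _<F_ (inverseʳ (inBlockRank-injective (α p)) r) (inverseʳ (inBlockRank-injective (α p)) s))
                                (<⇒<ᵇ r<s))))
      across : ∀ {p q : Fin n} → p Fin.< q → σ (combine p Fin.zero) Fin.< σ (combine q Fin.zero)
      across {p} {q} p<q = ≡.subst₂ _<_ (≡.cong toℕ (≡.sym (σ-combine p Fin.zero))) (≡.cong toℕ (≡.sym (σ-combine q Fin.zero)))
        (<ᵇ⇒< (≡.trans (≡.sym (rank-<F blockLead-injective (α p) (α q)))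
                       (≡.trans (≡.cong₂ _<F_ (inverseʳ (rank-injective blockLead-injective) p) (inverseʳ (rank-injective blockLead-injective) q))
                                (<⇒<ᵇ p<q))))

    assemble-decompose : ∀ i → assemble (decompose π) i ≡ π i
    assemble-decompose = combine-ext λ q r → begin
      assemble (decompose π) (combine q r)                  ≡⟨ assemble-combine σ α τ q r ⟩
      σ (combine (inverse α q) (τ (inverse α q) r))         ≡⟨ σ-combine (inverse α q) _ ⟩
      π (combine (α (inverse α q)) (inverse (τ (inverse α q)) (τ (inverse α q) r)))
        ≡⟨ ≡.cong₂ (λ q′ r′ → π (combine q′ r′)) (inverseʳ blockOrder-injective q) (inverseˡ (inBlockRank-injective (α (inverse α q))) r) ⟩
      π (combine q r)                                       ∎

  assemble-cong : ∀ {σ σ₁ α α₁ τ τ₁} → (∀ i → σ i ≡ σ₁ i) → (∀ p → α p ≡ α₁ p) → (∀ p r → τ p r ≡ τ₁ p r) →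
                  ∀ i → assemble (σ , α , τ) i ≡ assemble (σ₁ , α₁ , τ₁) i
  assemble-cong {σ} {σ₁} {α} {α₁} {τ} {τ₁} σ≗σ₁ α≗α₁ τ≗τ₁ = combine-ext λ q r → begin
    assemble (σ , α , τ) (combine q r)                ≡⟨ assemble-combine σ α τ q r ⟩
    σ (combine (inverse α q) (τ (inverse α q) r))     ≡⟨ ≡.cong (λ p → σ (combine p (τ p r))) (inverse-cong α≗α₁ q) ⟩
    σ (combine (inverse α₁ q) (τ (inverse α₁ q) r))   ≡⟨ ≡.trans (≡.cong (σ ∘ combine (inverse α₁ q)) (τ≗τ₁ _ r)) (σ≗σ₁ _) ⟩
    σ₁ (combine (inverse α₁ q) (τ₁ (inverse α₁ q) r)) ≡⟨ assemble-combine σ₁ α₁ τ₁ q r ⟨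
    assemble (σ₁ , α₁ , τ₁) (combine q r)             ∎

  module _ {π π₁ : Fin N → Fin N} (π≗π₁ : ∀ i → π i ≡ π₁ i) where

    inBlockRank-cong : ∀ q r → inBlockRank π q r ≡ inBlockRank π₁ q r
    inBlockRank-cong q = rank-cong (λ r → ≡.cong toℕ (π≗π₁ (combine q r)))

    blockOrder-cong : ∀ p → blockOrder π p ≡ blockOrder π₁ p
    blockOrder-cong = inverse-cong (rank-cong λ q →
      ≡.trans (≡.cong (λ r → toℕ (π (combine q r))) (inverse-cong (inBlockRank-cong q) Fin.zero)) (≡.cong toℕ (π≗π₁ _)))

    decompose-cong₂ : ∀ p r → inBlockRank π (blockOrder π p) r ≡ inBlockRank π₁ (blockOrder π₁ p) r
    decompose-cong₂ p r = ≡.trans (≡.cong (λ q → inBlockRank π q r) (blockOrder-cong p)) (inBlockRank-cong _ r)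

    decompose-cong₁ : ∀ i → proj₁ (decompose π) i ≡ proj₁ (decompose π₁) i
    decompose-cong₁ = combine-ext λ p s → begin
      proj₁ (decompose π) (combine p s)
        ≡⟨ ≡.cong π (blockMap-combine (blockOrder π) (λ p → inverse (inBlockRank π (blockOrder π p))) p s) ⟩
      π (combine (blockOrder π p) (inverse (inBlockRank π (blockOrder π p)) s))
        ≡⟨ ≡.cong₂ (λ q r → π (combine q r)) (blockOrder-cong p) (inverse-cong (decompose-cong₂ p) s) ⟩
      π (combine (blockOrder π₁ p) (inverse (inBlockRank π₁ (blockOrder π₁ p)) s))
        ≡⟨ π≗π₁ _ ⟩
      π₁ (combine (blockOrder π₁ p) (inverse (inBlockRank π₁ (blockOrder π₁ p)) s))
        ≡⟨ ≡.cong π₁ (blockMap-combine (blockOrder π₁) (λ p → inverse (inBlockRank π₁ (blockOrder π₁ p))) p s) ⟨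
      proj₁ (decompose π₁) (combine p s) ∎

-- Coefficients in the free module, and of shuffles with one-letter words

module Coefficients {c ℓ} (R : CommutativeRing c ℓ) {L : Set} (_≟L_ : DecidableEquality L) where
  open CommutativeRing R
  open FreeModule R L _≟L_
  open ListSum commutativeSemiring
  open import Algebra.Properties.CommutativeSemigroup *-commutativeSemigroup using (x∙yz≈y∙xz; interchange)
  open import Relation.Binary.Reasoning.Setoid setoid

  𝟙[_≡_] : Word → Word → Carrier
  𝟙[ u ≡ v ] = 𝟙 (does (u ≟W v))

  𝟙-∷ : ∀ a u b v → 𝟙[ a ∷ u ≡ b ∷ v ] ≈ 𝟙 (does (a ≟L b)) * 𝟙[ u ≡ v ]
  𝟙-∷ a u b v = trans (reflexive (≡.cong 𝟙 (does-⇔ (mk⇔ (λ e → List.∷-injectiveˡ e , List.∷-injectiveʳ e) (uncurry (≡.cong₂ _∷_)))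
                                                      ((a ∷ u) ≟W (b ∷ v)) ((a ≟L b) ×-dec (u ≟W v)))))
                      (𝟙-∧ (does (a ≟L b)) (does (u ≟W v)))

  coeff-∑ₗ : ∀ w (x : Lin) → coeff w x ≈ ∑[ e ∈ x ] (𝟙[ w ≡ proj₂ e ] * proj₁ e)
  coeff-∑ₗ w []            = refl
  coeff-∑ₗ w ((a , v) ∷ x) = +-cong (if-𝟙 (does (w ≟W v))) (coeff-∑ₗ w x)
    where
    if-𝟙 : ∀ b → (if b then a else 0#) ≈ 𝟙 b * a
    if-𝟙 true  = sym (*-identityˡ a)
    if-𝟙 false = sym (zeroˡ a)

  coeff-⊕ : ∀ w (x y : Lin) → coeff w (x ⊕ y) ≈ coeff w x + coeff w y
  coeff-⊕ w x y = begin
    coeff w (x ++ y)                                                        ≈⟨ coeff-∑ₗ w (x ++ y) ⟩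
    ∑[ e ∈ x ++ y ] (𝟙[ w ≡ proj₂ e ] * proj₁ e)                            ≈⟨ ∑ₗ-++ x y _ ⟩
    ∑[ e ∈ x ] (𝟙[ w ≡ proj₂ e ] * proj₁ e) + ∑[ e ∈ y ] (𝟙[ w ≡ proj₂ e ] * proj₁ e) ≈⟨ +-cong (coeff-∑ₗ w x) (coeff-∑ₗ w y) ⟨
    coeff w x + coeff w y                                                   ∎

  coeff-concatMap : ∀ {a} {X : Set a} w (xs : List X) (f : X → Lin) → coeff w (concatMap f xs) ≈ ∑[ x ∈ xs ] coeff w (f x)
  coeff-concatMap w xs f = begin
    coeff w (concatMap f xs)                                     ≈⟨ coeff-∑ₗ w (concatMap f xs) ⟩
    ∑[ e ∈ concatMap f xs ] (𝟙[ w ≡ proj₂ e ] * proj₁ e)         ≈⟨ ∑ₗ-concatMap f xs _ ⟩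
    ∑[ x ∈ xs ] ∑[ e ∈ f x ] (𝟙[ w ≡ proj₂ e ] * proj₁ e)        ≈⟨ ∑ₗ-cong xs (λ x → coeff-∑ₗ w (f x)) ⟨
    ∑[ x ∈ xs ] coeff w (f x)                                    ∎

  coeff-⊙ : ∀ w a (x : Lin) → coeff w (a ⊙ x) ≈ a * coeff w x
  coeff-⊙ w a x = begin
    coeff w (a ⊙ x)                                  ≈⟨ coeff-∑ₗ w (a ⊙ x) ⟩
    ∑[ e ∈ a ⊙ x ] (𝟙[ w ≡ proj₂ e ] * proj₁ e)      ≡⟨ ∑ₗ-map _ x _ ⟩
    ∑[ e ∈ x ] (𝟙[ w ≡ proj₂ e ] * (a * proj₁ e))    ≈⟨ ∑ₗ-cong x (λ e → x∙yz≈y∙xz _ a _) ⟩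
    ∑[ e ∈ x ] (a * (𝟙[ w ≡ proj₂ e ] * proj₁ e))    ≈⟨ *-distribˡ-∑ₗ x a _ ⟨
    a * ∑[ e ∈ x ] (𝟙[ w ≡ proj₂ e ] * proj₁ e)      ≈⟨ *-congˡ (coeff-∑ₗ w x) ⟨
    a * coeff w x                                    ∎

  coeff-⟦⟧ : ∀ w v → coeff w ⟦ v ⟧ ≈ 𝟙[ w ≡ v ]
  coeff-⟦⟧ w v = trans (coeff-∑ₗ w ⟦ v ⟧) (trans (+-identityʳ _) (*-identityʳ _))

  coeff-prefix : ∀ c w a x → coeff (c ∷ w) (prefix a x) ≈ 𝟙 (does (c ≟L a)) * coeff w x
  coeff-prefix c w a x = begin
    coeff (c ∷ w) (prefix a x)                                 ≈⟨ coeff-∑ₗ (c ∷ w) (prefix a x) ⟩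
    ∑[ e ∈ prefix a x ] (𝟙[ c ∷ w ≡ proj₂ e ] * proj₁ e)        ≡⟨ ∑ₗ-map _ x _ ⟩
    ∑[ e ∈ x ] (𝟙[ c ∷ w ≡ a ∷ proj₂ e ] * proj₁ e)             ≈⟨ ∑ₗ-cong x (λ e → trans (*-congʳ (𝟙-∷ c w a (proj₂ e))) (*-assoc _ _ _)) ⟩
    ∑[ e ∈ x ] (𝟙 (does (c ≟L a)) * (𝟙[ w ≡ proj₂ e ] * proj₁ e)) ≈⟨ *-distribˡ-∑ₗ x _ _ ⟨
    𝟙 (does (c ≟L a)) * ∑[ e ∈ x ] (𝟙[ w ≡ proj₂ e ] * proj₁ e)   ≈⟨ *-congˡ (coeff-∑ₗ w x) ⟨
    𝟙 (does (c ≟L a)) * coeff w x                               ∎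

  coeff-[]-prefix : ∀ a x → coeff [] (prefix a x) ≈ 0#
  coeff-[]-prefix a x = begin
    coeff [] (prefix a x)                            ≈⟨ coeff-∑ₗ [] (prefix a x) ⟩
    ∑[ e ∈ prefix a x ] (𝟙[ [] ≡ proj₂ e ] * proj₁ e) ≡⟨ ∑ₗ-map _ x _ ⟩
    ∑[ e ∈ x ] (0# * proj₁ e)                         ≈⟨ ∑ₗ-cong x (λ e → zeroˡ _) ⟩
    ∑[ e ∈ x ] 0#                                     ≈⟨ ∑ₗ-zero x ⟩
    0#                                                ∎

  -- Past the end of w, letterAt gives [] and deleteAt gives w.
  letterAt : Word → ℕ → Word
  letterAt []      j       = []
  letterAt (a ∷ w) zero    = a ∷ []
  letterAt (a ∷ w) (suc j) = letterAt w j

  deleteAt : Word → ℕ → Word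
  deleteAt []      j       = []
  deleteAt (a ∷ w) zero    = w
  deleteAt (a ∷ w) (suc j) = a ∷ deleteAt w j

  length-deleteAt : ∀ c w (j : Fin (suc (length w))) → length (deleteAt (c ∷ w) (toℕ j)) ≡ length w
  length-deleteAt c w       Fin.zero    = ≡.refl
  length-deleteAt c (d ∷ w) (Fin.suc j) = ≡.cong suc (length-deleteAt d w j)

  letterAt-deleteAt : ∀ w {n} (j : Fin (suc n)) (t : Fin n) → letterAt (deleteAt w (toℕ j)) (toℕ t) ≡ letterAt w (toℕ (punchIn j t))
  letterAt-deleteAt []      Fin.zero    t           = ≡.refl
  letterAt-deleteAt (a ∷ w) Fin.zero    t           = ≡.refl
  letterAt-deleteAt []      (Fin.suc j) Fin.zero    = ≡.refl
  letterAt-deleteAt (a ∷ w) (Fin.suc j) Fin.zero    = ≡.refl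
  letterAt-deleteAt []      (Fin.suc j) (Fin.suc t) = ≡.refl
  letterAt-deleteAt (a ∷ w) (Fin.suc j) (Fin.suc t) = letterAt-deleteAt w j t

  splits : L → Word → (w : Word) → Fin (length w) → Carrier
  splits l v w j = 𝟙[ letterAt w (toℕ j) ≡ l ∷ [] ] * 𝟙[ deleteAt w (toℕ j) ≡ v ]

  ∑-splits : ∀ l v c w → ∑ₗ (allFin (length (c ∷ w))) (splits l v (c ∷ w))
                         ≡ splits l v (c ∷ w) Fin.zero + ∑[ j ∈ allFin (length w) ] splits l v (c ∷ w) (Fin.suc j)
  ∑-splits l v c w = ≡.cong (splits l v (c ∷ w) Fin.zero +_) (∑ₗ-tabulate-suc (splits l v (c ∷ w)))

  [c]≡[l] : ∀ c l → 𝟙 (does (c ≟L l)) ≈ 𝟙[ c ∷ [] ≡ l ∷ [] ]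
  [c]≡[l] c l = trans (sym (*-identityʳ _)) (sym (𝟙-∷ c [] l []))

  coeff-shW-letter : ∀ l v w → coeff w (shW (l ∷ []) v) ≈ ∑ₗ (allFin (length w)) (splits l v w)
  coeff-shW-letter l []      []      = coeff-⟦⟧ [] (l ∷ [])
  coeff-shW-letter l []      (c ∷ w) = begin
    coeff (c ∷ w) ⟦ l ∷ [] ⟧                                       ≈⟨ coeff-⟦⟧ (c ∷ w) (l ∷ []) ⟩
    𝟙[ c ∷ w ≡ l ∷ [] ]                                            ≈⟨ 𝟙-∷ c w l [] ⟩
    𝟙 (does (c ≟L l)) * 𝟙[ w ≡ [] ]                                ≈⟨ *-congʳ ([c]≡[l] c l) ⟩
    splits l [] (c ∷ w) Fin.zero                                   ≈⟨ +-identityʳ _ ⟨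
    splits l [] (c ∷ w) Fin.zero + 0#                              ≈⟨ +-congˡ (∑ₗ-zero (allFin (length w))) ⟨
    splits l [] (c ∷ w) Fin.zero + ∑[ j ∈ allFin (length w) ] 0#
      ≈⟨ +-congˡ (∑ₗ-cong (allFin (length w)) (λ j → zeroʳ 𝟙[ letterAt w (toℕ j) ≡ l ∷ [] ])) ⟨
    splits l [] (c ∷ w) Fin.zero + ∑[ j ∈ allFin (length w) ] splits l [] (c ∷ w) (Fin.suc j)
      ≡⟨ ∑-splits l [] c w ⟨
    ∑ₗ (allFin (length (c ∷ w))) (splits l [] (c ∷ w))            ∎
  coeff-shW-letter l (b ∷ v) []      = trans (coeff-⊕ [] (prefix l ⟦ b ∷ v ⟧) (prefix b (shW (l ∷ []) v)))
    (trans (+-cong (coeff-[]-prefix l ⟦ b ∷ v ⟧) (coeff-[]-prefix b (shW (l ∷ []) v))) (+-identityʳ _))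
  coeff-shW-letter l (b ∷ v) (c ∷ w) = begin
    coeff (c ∷ w) (prefix l ⟦ b ∷ v ⟧ ⊕ prefix b (shW (l ∷ []) v))
      ≈⟨ coeff-⊕ (c ∷ w) (prefix l ⟦ b ∷ v ⟧) (prefix b (shW (l ∷ []) v)) ⟩
    coeff (c ∷ w) (prefix l ⟦ b ∷ v ⟧) + coeff (c ∷ w) (prefix b (shW (l ∷ []) v))
      ≈⟨ +-cong (coeff-prefix c w l ⟦ b ∷ v ⟧) (coeff-prefix c w b (shW (l ∷ []) v)) ⟩
    𝟙 (does (c ≟L l)) * coeff w ⟦ b ∷ v ⟧ + 𝟙 (does (c ≟L b)) * coeff w (shW (l ∷ []) v)
      ≈⟨ +-cong (*-cong ([c]≡[l] c l) (coeff-⟦⟧ w (b ∷ v))) (*-congˡ (coeff-shW-letter l v w)) ⟩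
    splits l (b ∷ v) (c ∷ w) Fin.zero + 𝟙 (does (c ≟L b)) * ∑ₗ (allFin (length w)) (splits l v w)
      ≈⟨ +-congˡ (*-distribˡ-∑ₗ (allFin (length w)) (𝟙 (does (c ≟L b))) (splits l v w)) ⟩
    splits l (b ∷ v) (c ∷ w) Fin.zero + ∑[ j ∈ allFin (length w) ] (𝟙 (does (c ≟L b)) * splits l v w j)
      ≈⟨ +-congˡ (∑ₗ-cong (allFin (length w)) prepend) ⟩
    splits l (b ∷ v) (c ∷ w) Fin.zero + ∑[ j ∈ allFin (length w) ] splits l (b ∷ v) (c ∷ w) (Fin.suc j)
      ≡⟨ ∑-splits l (b ∷ v) c w ⟨
    ∑ₗ (allFin (length (c ∷ w))) (splits l (b ∷ v) (c ∷ w))        ∎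
    where
    prepend : ∀ j → 𝟙 (does (c ≟L b)) * splits l v w j ≈ splits l (b ∷ v) (c ∷ w) (Fin.suc j)
    prepend j = trans (x∙yz≈y∙xz _ _ _) (*-congˡ (sym (𝟙-∷ c (deleteAt w (toℕ j)) b v)))

  SingleLetters : Lin → Set c
  SingleLetters x = All (λ e → ∃ λ l → proj₂ e ≡ l ∷ []) x

  coeff-ш : ∀ {x} y w → SingleLetters x →
            coeff w (x ш y) ≈ ∑[ j ∈ allFin (length w) ] (coeff (letterAt w (toℕ j)) x * coeff (deleteAt w (toℕ j)) y)
  coeff-ш {x} y w x-letters = begin
    coeff w (x ш y)
      ≈⟨ coeff-concatMap w x _ ⟩
    ∑[ e ∈ x ] coeff w (concatMap (λ e′ → (proj₁ e * proj₁ e′) ⊙ shW (proj₂ e) (proj₂ e′)) y)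
      ≈⟨ ∑ₗ-cong-All x-letters (λ e e-letter → trans (coeff-concatMap w y _) (∑ₗ-cong y (expand e e-letter))) ⟩
    ∑[ e ∈ x ] ∑[ e′ ∈ y ] ∑[ j ∈ J ] (P j e * Q j e′) ≈⟨ ∑ₗ-cong x (λ e → ∑ₗ-comm y J _) ⟩
    ∑[ e ∈ x ] ∑[ j ∈ J ] ∑[ e′ ∈ y ] (P j e * Q j e′) ≈⟨ ∑ₗ-comm x J _ ⟩
    ∑[ j ∈ J ] ∑[ e ∈ x ] ∑[ e′ ∈ y ] (P j e * Q j e′) ≈⟨ ∑ₗ-cong J (λ j → ∑ₗ*∑ₗ≈∑ₗ∑ₗ x y (P j) (Q j)) ⟨
    ∑[ j ∈ J ] (∑ₗ x (P j) * ∑ₗ y (Q j))             ≈⟨ ∑ₗ-cong J (λ j → *-cong (coeff-∑ₗ _ x) (coeff-∑ₗ _ y)) ⟨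
    ∑[ j ∈ J ] (coeff (letterAt w (toℕ j)) x * coeff (deleteAt w (toℕ j)) y) ∎
    where
    J = allFin (length w)
    P = λ (j : Fin (length w)) (e : Carrier × Word) → 𝟙[ letterAt w (toℕ j) ≡ proj₂ e ] * proj₁ e
    Q = λ (j : Fin (length w)) (e : Carrier × Word) → 𝟙[ deleteAt w (toℕ j) ≡ proj₂ e ] * proj₁ e

    expand : ∀ e → (∃ λ l → proj₂ e ≡ l ∷ []) → ∀ e′ →
             coeff w ((proj₁ e * proj₁ e′) ⊙ shW (proj₂ e) (proj₂ e′)) ≈ ∑[ j ∈ J ] (P j e * Q j e′)
    expand (a , _) (l , ≡.refl) (b , v) = begin
      coeff w ((a * b) ⊙ shW (l ∷ []) v)     ≈⟨ coeff-⊙ w (a * b) (shW (l ∷ []) v) ⟩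
      (a * b) * coeff w (shW (l ∷ []) v)     ≈⟨ *-congˡ (coeff-shW-letter l v w) ⟩
      (a * b) * ∑ₗ J (splits l v w)          ≈⟨ *-distribˡ-∑ₗ J (a * b) (splits l v w) ⟩
      ∑[ j ∈ J ] ((a * b) * splits l v w j)  ≈⟨ ∑ₗ-cong J (λ j → trans (interchange a b _ _) (*-cong (*-comm a _) (*-comm b _))) ⟩
      ∑[ j ∈ J ] (P j (a , l ∷ []) * Q j (b , v)) ∎

  module _ {n} (f : Fin (suc n) → Lin) where
    open Enumeration commutativeSemiring

    placement : Word → (Fin (suc n) → Fin (suc n)) → Carrier
    placement W β = ∏[ p < suc n ] coeff (letterAt W (toℕ (β p))) (f p)

    expansionWithout : Word → ℕ → Carrier
    expansionWithout W j = ∑[ α ∈ perms n ] ∏[ p < n ] coeff (letterAt (deleteAt W j) (toℕ (α p))) (f (Fin.suc p))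

    firstIndex-letter-expansion : ∀ W → ∑[ j ∈ allFin (suc n) ] (coeff (letterAt W (toℕ j)) (f Fin.zero) * expansionWithout W (toℕ j))
                                   ≈ ∑[ β ∈ perms (suc n) ] placement W β
    firstIndex-letter-expansion W = begin
      ∑[ j ∈ allFin (suc n) ] (coeff (letterAt W (toℕ j)) (f Fin.zero) * expansionWithout W (toℕ j))
        ≈⟨ ∑ₗ-cong (allFin (suc n)) (λ j → trans (*-distribˡ-∑ₗ (perms n) _ _) (∑ₗ-cong (perms n) (λ α →
             *-congˡ (product-cong {n} (λ p → reflexive (≡.cong (λ u → coeff u (f (Fin.suc p))) (letterAt-deleteAt W j (α p)))))))) ⟩
      ∑[ j ∈ allFin (suc n) ] ∑[ α ∈ perms n ] placement W (insert (j , α))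
        ≈⟨ ∑ₗ-cartesianProduct (allFin (suc n)) (perms n) (placement W ∘ insert) ⟨
      ∑[ jα ∈ cartesianProduct (allFin (suc n)) (perms n) ] placement W (insert jα)
        ≈⟨ ∑ₗ-reindex (cartesianProduct-enumerates (allFin-enumerates (suc n)) (perms-enumerate n)) (perms-enumerate (suc n))
                      (insertion n) (placement W) placement-cong ⟩
      ∑[ β ∈ perms (suc n) ] placement W β ∎
      where
      insert = Correspondence.to (insertion n)
      placement-cong : ∀ {β γ} → (∀ p → β p ≡ γ p) → placement W β ≈ placement W γ
      placement-cong β≗γ = product-cong {suc n} (λ p → reflexive (≡.cong (λ i → coeff (letterAt W (toℕ i)) (f p)) (β≗γ p)))

  coeff-shProd : ∀ n (f : Fin n → Lin) → (∀ p → SingleLetters (f p)) → ∀ w →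
                 coeff w (shProd n f) ≈ 𝟙 (length w ℕ.≡ᵇ n) * ∑[ β ∈ perms n ] ∏[ p < n ] coeff (letterAt w (toℕ (β p))) (f p)
  coeff-shProd zero    f _ []      = trans (coeff-⟦⟧ [] []) (sym (trans (*-identityˡ _) (+-identityʳ _)))
  coeff-shProd zero    f _ (c ∷ w) = trans (coeff-⟦⟧ (c ∷ w) []) (sym (zeroˡ _))
  coeff-shProd (suc n) f letters []      = trans (coeff-ш (shProd n (f ∘ Fin.suc)) [] (letters Fin.zero)) (sym (zeroˡ _))
  coeff-shProd (suc n) f letters (c ∷ w) = begin
    coeff W (f Fin.zero ш shProd n (f ∘ Fin.suc))
      ≈⟨ coeff-ш (shProd n (f ∘ Fin.suc)) W (letters Fin.zero) ⟩
    ∑[ j ∈ J ] (lead j * coeff (deleteAt W (toℕ j)) (shProd n (f ∘ Fin.suc)))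
      ≈⟨ ∑ₗ-cong J (λ j → *-congˡ (coeff-shProd n (f ∘ Fin.suc) (letters ∘ Fin.suc) (deleteAt W (toℕ j)))) ⟩
    ∑[ j ∈ J ] (lead j * (𝟙 (length (deleteAt W (toℕ j)) ℕ.≡ᵇ n) * rest j))
      ≈⟨ ∑ₗ-cong J (λ j → reflexive (≡.cong (λ k → lead j * (𝟙 (k ℕ.≡ᵇ n) * rest j)) (length-deleteAt c w j))) ⟩
    ∑[ j ∈ J ] (lead j * (𝟙 (len ℕ.≡ᵇ n) * rest j))     ≈⟨ ∑ₗ-cong J (λ j → x∙yz≈y∙xz _ _ _) ⟩
    ∑[ j ∈ J ] (𝟙 (len ℕ.≡ᵇ n) * (lead j * rest j))     ≈⟨ *-distribˡ-∑ₗ J _ _ ⟨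
    𝟙 (len ℕ.≡ᵇ n) * ∑[ j ∈ J ] (lead j * rest j)       ≈⟨ length-match ⟩
    𝟙 (len ℕ.≡ᵇ n) * ∑[ β ∈ perms (suc n) ] placement f W β ∎
    where
    W = c ∷ w
    len = length w
    J = allFin (suc len)
    lead = λ (j : Fin (suc len)) → coeff (letterAt W (toℕ j)) (f Fin.zero)
    rest = λ (j : Fin (suc len)) → expansionWithout f W (toℕ j)
    length-match : 𝟙 (len ℕ.≡ᵇ n) * ∑[ j ∈ J ] (lead j * rest j) ≈ 𝟙 (len ℕ.≡ᵇ n) * ∑[ β ∈ perms (suc n) ] placement f W β
    length-match with len ℕ.≡ᵇ n in len≡n
    ... | false = trans (zeroˡ _) (sym (zeroˡ _))
    ... | true  = *-congˡ (≡.subst (λ k → ∑[ j ∈ allFin (suc k) ] (coeff (letterAt W (toℕ j)) (f Fin.zero) * expansionWithout f W (toℕ j))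
                                          ≈ ∑[ β ∈ perms (suc n) ] placement f W β)
                                   (≡.sym (ℕ.≡ᵇ⇒≡ len n (Equivalence.from T-≡ len≡n))) (firstIndex-letter-expansion f W))

  𝟙-tabulate : ∀ n (g : Fin n → L) w →
               𝟙 (length w ℕ.≡ᵇ n) * ∏[ q < n ] 𝟙[ letterAt w (toℕ q) ≡ g q ∷ [] ] ≈ 𝟙[ w ≡ tabulate g ]
  𝟙-tabulate zero    g []      = *-identityˡ _
  𝟙-tabulate zero    g (c ∷ w) = zeroˡ _
  𝟙-tabulate (suc n) g []      = zeroˡ _
  𝟙-tabulate (suc n) g (c ∷ w) = begin
    𝟙 (length w ℕ.≡ᵇ n) * (𝟙[ c ∷ [] ≡ g Fin.zero ∷ [] ] * ∏[ q < n ] 𝟙[ letterAt w (toℕ q) ≡ g (Fin.suc q) ∷ [] ])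
      ≈⟨ x∙yz≈y∙xz _ _ _ ⟩
    𝟙[ c ∷ [] ≡ g Fin.zero ∷ [] ] * (𝟙 (length w ℕ.≡ᵇ n) * ∏[ q < n ] 𝟙[ letterAt w (toℕ q) ≡ g (Fin.suc q) ∷ [] ])
      ≈⟨ *-cong (trans (𝟙-∷ c [] (g Fin.zero) []) (*-identityʳ _)) (𝟙-tabulate n (g ∘ Fin.suc) w) ⟩
    𝟙 (does (c ≟L g Fin.zero)) * 𝟙[ w ≡ tabulate (g ∘ Fin.suc) ]
      ≈⟨ 𝟙-∷ c w (g Fin.zero) (tabulate (g ∘ Fin.suc)) ⟨
    𝟙[ c ∷ w ≡ tabulate g ] ∎

-- The identity, coefficient by coefficient

module ShuffleHyperpfaffian {c ℓ} (R : CommutativeRing c ℓ) (k′ n : ℕ) (i : Fin (n ℕ.* (2 ℕ.* suc k′)) → ℕ) where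
  open CommutativeRing R
  open ListSum commutativeSemiring
  open Enumeration commutativeSemiring
  open Sign R using (sign-∘; sign-blockMap; sign-cong)
  open Setting R (suc k′)
  open Coefficients R {Letter} (Vec.≡-dec ℕ._≟_)
  -- suc (k′ + suc (k′ + 0)) is 2 * suc k′ by definition, so the block sizes agree.
  open BlockDecomposition n (k′ ℕ.+ suc (k′ ℕ.+ 0))
  open import Algebra.Properties.CommutativeSemigroup *-commutativeSemigroup using (x∙yz≈y∙xz)
  open import Relation.Binary.Reasoning.Setoid setoid

  module _ (σ : Fin N → Fin N) where
    private
      increasing-within : Fin n → Fin m × Fin m → Bool
      increasing-within p (r , s) = not (r <F s) ∨' (σ (combine p r) <F σ (combine p s))

      increasing-across : Fin n × Fin n → Bool
      increasing-across (p , q) = not (p <F q) ∨' (σ (combine p Fin.zero) <F σ (combine q Fin.zero))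

    isE⇒sorted : isE (suc k′) n σ ≡ true → Sorted σ
    isE⇒sorted h = record
      { within = λ p {r} {s} r<s → <ᵇ⇒< (implies⇒ (allB-pairs⁻ (increasing-within p)
                                     (allB-allFin⁻ (λ p → allB (increasing-within p) (pairs m)) (∧-conicalˡ _ _ h) p) r s) (<⇒<ᵇ r<s))
      ; across = λ {p} {q} p<q → <ᵇ⇒< (implies⇒ (allB-pairs⁻ increasing-across (∧-conicalʳ _ _ h) p q) (<⇒<ᵇ p<q))
      }

    sorted⇒isE : Sorted σ → isE (suc k′) n σ ≡ true
    sorted⇒isE sorted = ∧-intro
      (allB-allFin⁺ (λ p → allB (increasing-within p) (pairs m)) (λ p → allB-pairs⁺ (increasing-within p) (λ r s → ⇒implies (<⇒<ᵇ ∘ within p ∘ <ᵇ⇒<))))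
      (allB-pairs⁺ increasing-across (λ p q → ⇒implies (<⇒<ᵇ ∘ across ∘ <ᵇ⇒<)))
      where open Sorted sorted

  wordOf : (Fin N → Fin N) → Word
  wordOf π = tabulate (λ (q : Fin n) → letter (λ r → i (π (combine q r))))

  coeff-lhs : ∀ w → coeff w (lhs n i) ≈ ∑[ π ∈ perms N ] (sgn π * 𝟙[ w ≡ wordOf π ])
  coeff-lhs w = trans (coeff-concatMap w (perms N) (λ π → sgn π ⊙ ⟦ word π ⟧)) (∑ₗ-cong (perms N) λ π → begin
    coeff w (sgn π ⊙ ⟦ word π ⟧)  ≈⟨ coeff-⊙ w (sgn π) ⟦ word π ⟧ ⟩
    sgn π * coeff w ⟦ word π ⟧    ≈⟨ *-congˡ (coeff-⟦⟧ w (word π)) ⟩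
    sgn π * 𝟙[ w ≡ word π ]       ≡⟨ ≡.cong (λ v → sgn π * 𝟙[ w ≡ v ]) (List.map-tabulate id _) ⟩
    sgn π * 𝟙[ w ≡ wordOf π ]     ∎)
    where
    word : (Fin N → Fin N) → Word
    word π = map (λ (q : Fin n) → letter (λ r → i (π (combine q r)))) (allFin n)

  𝐒-letters : ∀ j → SingleLetters (𝐒 j)
  𝐒-letters j = All.concat⁺ (All.map⁺ (All.universal (λ τ → (letter (j ∘ τ) , ≡.refl) ∷ []) (perms m)))

  coeff-𝐒 : ∀ u j → coeff u (𝐒 j) ≈ ∑[ τ ∈ perms m ] (sgn τ * 𝟙[ u ≡ letter (j ∘ τ) ∷ [] ])
  coeff-𝐒 u j = trans (coeff-concatMap u (perms m) (λ τ → sgn τ ⊙ ⟦ letter (j ∘ τ) ∷ [] ⟧))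
    (∑ₗ-cong (perms m) (λ τ → trans (coeff-⊙ u (sgn τ) ⟦ letter (j ∘ τ) ∷ [] ⟧) (*-congˡ (coeff-⟦⟧ u (letter (j ∘ τ) ∷ [])))))

  blockLetter : (Fin N → Fin N) → Fin n → (Fin m → Fin m) → Letter
  blockLetter σ p τ = letter (λ r → i (σ (combine p (τ r))))

  block : (Fin N → Fin N) → Fin n → Lin
  block σ p = 𝐒 (λ r → i (σ (combine p r)))

  fits : Word → (Fin N → Fin N) → (Fin n → Fin n) → Fin n → (Fin m → Fin m) → Carrier
  fits w σ α p τ = 𝟙[ letterAt w (toℕ (α p)) ≡ blockLetter σ p τ ∷ [] ]

  term : Word → Triple → Carrier
  term w (σ , α , τ) = sgn σ * (𝟙 (length w ℕ.≡ᵇ n) * ∏[ p < n ] (sgn (τ p) * fits w σ α p (τ p)))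

  coeff-shProd-𝐒 : ∀ w σ → coeff w (shProd n (block σ)) ≈
    ∑[ α ∈ perms n ] ∑[ τ ∈ tuples n (perms m) ] (𝟙 (length w ℕ.≡ᵇ n) * ∏[ p < n ] (sgn (τ p) * fits w σ α p (τ p)))
  coeff-shProd-𝐒 w σ = begin
    coeff w (shProd n (block σ))
      ≈⟨ coeff-shProd n (block σ) (λ p → 𝐒-letters (λ r → i (σ (combine p r)))) w ⟩
    B * ∑[ α ∈ perms n ] ∏[ p < n ] coeff (letterAt w (toℕ (α p))) (block σ p)
      ≈⟨ *-congˡ (∑ₗ-cong (perms n) (λ α → product-cong {n} (λ p → coeff-𝐒 (letterAt w (toℕ (α p))) (λ r → i (σ (combine p r)))))) ⟩
    B * ∑[ α ∈ perms n ] ∏[ p < n ] ∑[ τ ∈ perms m ] (sgn τ * fits w σ α p τ)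
      ≈⟨ *-congˡ (∑ₗ-cong (perms n) (λ α → ∏∑ₗ≈∑ₗ∏ n (perms m) (λ p τ → sgn τ * fits w σ α p τ))) ⟩
    B * ∑[ α ∈ perms n ] ∑[ τ ∈ tuples n (perms m) ] ∏[ p < n ] (sgn (τ p) * fits w σ α p (τ p))
      ≈⟨ *-distribˡ-∑ₗ∑ₗ (perms n) (tuples n (perms m)) B _ ⟩
    ∑[ α ∈ perms n ] ∑[ τ ∈ tuples n (perms m) ] (B * ∏[ p < n ] (sgn (τ p) * fits w σ α p (τ p))) ∎
    where B = 𝟙 (length w ℕ.≡ᵇ n)

  coeff-PfШ : ∀ w → coeff w (PfШ n 𝐒 i) ≈
              ∑[ σ ∈ permsE (suc k′) n ] ∑[ α ∈ perms n ] ∑[ τ ∈ tuples n (perms m) ] term w (σ , α , τ)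
  coeff-PfШ w = trans (coeff-concatMap w (permsE (suc k′) n) (λ σ → sgn σ ⊙ shProd n (block σ)))
    (∑ₗ-cong (permsE (suc k′) n) λ σ → begin
      coeff w (sgn σ ⊙ shProd n (block σ))  ≈⟨ coeff-⊙ w (sgn σ) (shProd n (block σ)) ⟩
      sgn σ * coeff w (shProd n (block σ))  ≈⟨ *-congˡ (coeff-shProd-𝐒 w σ) ⟩
      sgn σ * ∑[ α ∈ perms n ] ∑[ τ ∈ tuples n (perms m) ] (B * ∏[ p < n ] (sgn (τ p) * fits w σ α p (τ p)))
        ≈⟨ *-distribˡ-∑ₗ∑ₗ (perms n) (tuples n (perms m)) (sgn σ) _ ⟩
      ∑[ α ∈ perms n ] ∑[ τ ∈ tuples n (perms m) ] term w (σ , α , τ) ∎)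
    where B = 𝟙 (length w ℕ.≡ᵇ n)

  module _ {σ : Fin N → Fin N} {α : Fin n → Fin n} {τ : Fin n → Fin m → Fin m}
           (σ-inj : Injective _≡_ _≡_ σ) (α-inj : Injective _≡_ _≡_ α) (τ-inj : ∀ p → Injective _≡_ _≡_ (τ p)) where
    private
      π = assemble (σ , α , τ)
      α⁻¹-inj = inverse-injective α-inj

    sgn-assemble : sgn π ≈ sgn σ * ∏[ p < n ] sgn (τ p)
    sgn-assemble = begin
      sgn π                                          ≈⟨ sign-∘ σ-inj (blockMap-injective α⁻¹-inj (λ q → τ-inj (inverse α q))) ⟩
      sgn σ * sgn (blockMap (inverse α) (τ ∘ inverse α)) ≈⟨ *-congˡ (sign-blockMap (suc k′) (τ ∘ inverse α) α⁻¹-inj) ⟩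
      sgn σ * ∏[ q < n ] sgn (τ (inverse α q))       ≈⟨ *-congˡ (∏-permute (sgn ∘ τ) (toPermutation α⁻¹-inj)) ⟨
      sgn σ * ∏[ p < n ] sgn (τ p)                   ∎

    blockLetter-assemble : ∀ p → blockLetter σ p (τ p) ≡ letter (λ r → i (π (combine (α p) r)))
    blockLetter-assemble p = Vec.tabulate-cong (λ r → ≡.cong i (≡.sym
      (≡.trans (assemble-combine σ α τ (α p) r) (≡.cong (λ q → σ (combine q (τ q r))) (inverseˡ α-inj p)))))

    𝟙-assemble : ∀ w → 𝟙 (length w ℕ.≡ᵇ n) * ∏[ p < n ] fits w σ α p (τ p) ≈ 𝟙[ w ≡ wordOf π ]
    𝟙-assemble w = begin
      B * ∏[ p < n ] fits w σ α p (τ p)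
        ≈⟨ *-congˡ (product-cong {n} (λ p → reflexive (≡.cong (λ l → 𝟙[ letterAt w (toℕ (α p)) ≡ l ∷ [] ]) (blockLetter-assemble p)))) ⟩
      B * ∏[ p < n ] 𝟙[ letterAt w (toℕ (α p)) ≡ Lπ (α p) ∷ [] ]
        ≈⟨ *-congˡ (∏-permute (λ q → 𝟙[ letterAt w (toℕ q) ≡ Lπ q ∷ [] ]) (toPermutation α-inj)) ⟨
      B * ∏[ q < n ] 𝟙[ letterAt w (toℕ q) ≡ Lπ q ∷ [] ]
        ≈⟨ 𝟙-tabulate n Lπ w ⟩
      𝟙[ w ≡ wordOf π ] ∎
      where
      B = 𝟙 (length w ℕ.≡ᵇ n)
      Lπ = λ (q : Fin n) → letter (λ r → i (π (combine q r)))

    term-assemble : ∀ w → term w (σ , α , τ) ≈ sgn π * 𝟙[ w ≡ wordOf π ]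
    term-assemble w = begin
      sgn σ * (B * ∏[ p < n ] (sgn (τ p) * I p))                    ≈⟨ *-congˡ (*-congˡ (∏-distrib-* (sgn ∘ τ) I)) ⟩
      sgn σ * (B * (∏[ p < n ] sgn (τ p) * ∏[ p < n ] I p))         ≈⟨ *-congˡ (x∙yz≈y∙xz B _ _) ⟩
      sgn σ * (∏[ p < n ] sgn (τ p) * (B * ∏[ p < n ] I p))         ≈⟨ *-assoc _ _ _ ⟨
      (sgn σ * ∏[ p < n ] sgn (τ p)) * (B * ∏[ p < n ] I p)         ≈⟨ *-cong (sym sgn-assemble) (𝟙-assemble w) ⟩
      sgn π * 𝟙[ w ≡ wordOf π ]                                     ∎
      where
      B = 𝟙 (length w ℕ.≡ᵇ n)
      I = λ (p : Fin n) → fits w σ α p (τ p)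

  Triples : DecSetoid 0ℓ 0ℓ
  Triples = ×-decSetoid (Endo N) (×-decSetoid (Endo n) (Pointwise.decSetoid (Endo m) n))

  validTriple : Triple → Bool
  validTriple (σ , α , τ) = (isE (suc k′) n σ ∧ isPerm σ) ∧ (isPerm α ∧ allᵇ isPerm τ)

  valid⇒ : ∀ {σ α τ} → validTriple (σ , α , τ) ≡ true →
           Sorted σ × Injective _≡_ _≡_ σ × Injective _≡_ _≡_ α × (∀ p → Injective _≡_ _≡_ (τ p))
  valid⇒ {σ} {α} {τ} h =
      isE⇒sorted σ (∧-conicalˡ E (isPerm σ) left)
    , isPerm⇒injective σ (∧-conicalʳ E (isPerm σ) left)
    , isPerm⇒injective α (∧-conicalˡ (isPerm α) (allᵇ isPerm τ) right)
    , λ p → isPerm⇒injective (τ p) (allᵇ-sound isPerm τ (∧-conicalʳ (isPerm α) (allᵇ isPerm τ) right) p)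
    where
    E = isE (suc k′) n σ
    left = ∧-conicalˡ (E ∧ isPerm σ) (isPerm α ∧ allᵇ isPerm τ) h
    right = ∧-conicalʳ (E ∧ isPerm σ) (isPerm α ∧ allᵇ isPerm τ) h

  isE-cong : ∀ {σ σ₁} → (∀ x → σ x ≡ σ₁ x) → isE (suc k′) n σ ≡ isE (suc k′) n σ₁
  isE-cong {σ} {σ₁} σ≗σ₁ = ⇔→≡ {z = true} (mk⇔
    (sorted⇒isE σ₁ ∘ Sorted-cong σ≗σ₁ ∘ isE⇒sorted σ)
    (sorted⇒isE σ ∘ Sorted-cong (≡.sym ∘ σ≗σ₁) ∘ isE⇒sorted σ₁))

  triples : List Triple
  triples = cartesianProduct (permsE (suc k′) n) (cartesianProduct (perms n) (tuples n (perms m)))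

  triples-enumerate : Enumerates Triples validTriple triples
  triples-enumerate = cartesianProduct-enumerates
    (filter-enumerates (perms-enumerate N) (isE (suc k′) n) isE-cong)
    (cartesianProduct-enumerates (perms-enumerate n) (tuples-enumerate (perms-enumerate m) n))

  decompose-valid : ∀ {π} → isPerm π ≡ true → validTriple (decompose π) ≡ true
  decompose-valid {π} h = ∧-intro
    (∧-intro (sorted⇒isE σ (decompose-sorted π-inj)) (injective⇒isPerm σ (decompose-injective π-inj)))
    (∧-intro (injective⇒isPerm (blockOrder π) (blockOrder-injective π-inj))
             (allᵇ-complete isPerm τ (λ p → injective⇒isPerm (τ p) (inBlockRank-injective π-inj (blockOrder π p)))))
    where
    π-inj = isPerm⇒injective π h
    σ = proj₁ (decompose π)
    τ = proj₂ (proj₂ (decompose π))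

  assembly : Correspondence Triples (Endo N) validTriple isPerm
  assembly = record
    { to          = assemble
    ; from        = decompose
    ; to-cong     = λ { (σ≗σ₁ , α≗α₁ , τ≗τ₁) → assemble-cong σ≗σ₁ α≗α₁ τ≗τ₁ }
    ; from-cong   = λ π≗π₁ → decompose-cong₁ π≗π₁ , blockOrder-cong π≗π₁ , decompose-cong₂ π≗π₁
    ; to-closed   = λ { {σ , α , τ} h → let (_ , σ-inj , α-inj , τ-inj) = valid⇒ {σ} {α} {τ} h in
                        injective⇒isPerm (assemble (σ , α , τ)) (assemble-injective σ-inj α-inj τ-inj) }
    ; from-closed = λ {π} → decompose-valid {π}
    ; from∘to     = λ { {σ , α , τ} h → let (sorted , _ , α-inj , τ-inj) = valid⇒ {σ} {α} {τ} h in
                        decompose-assemble₁ sorted α-inj τ-inj , blockOrder-assemble sorted α-inj τ-inj , inBlockRank-blockOrder sorted α-inj τ-inj }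
    ; to∘from     = λ {π} h → assemble-decompose (isPerm⇒injective π h)
    }

  coeff-lhs≈coeff-PfШ : ∀ w → coeff w (lhs n i) ≈ coeff w (PfШ n 𝐒 i)
  coeff-lhs≈coeff-PfШ w = begin
    coeff w (lhs n i)                                                ≈⟨ coeff-lhs w ⟩
    ∑[ π ∈ perms N ] F π                                             ≈⟨ ∑ₗ-reindex triples-enumerate (perms-enumerate N) assembly F F-cong ⟨
    ∑[ t ∈ triples ] F (assemble t)                                  ≈⟨ ∑ₗ-cong-All (Enumerates.members triples-enumerate) assembled-term ⟨
    ∑[ t ∈ triples ] term w t                                        ≈⟨ ∑ₗ-cartesianProduct (permsE (suc k′) n) _ (term w) ⟩
    ∑[ σ ∈ permsE (suc k′) n ] ∑[ ατ ∈ cartesianProduct (perms n) (tuples n (perms m)) ] term w (σ , ατ)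
      ≈⟨ ∑ₗ-cong (permsE (suc k′) n) (λ σ → ∑ₗ-cartesianProduct (perms n) (tuples n (perms m)) (term w ∘ (σ ,_))) ⟩
    ∑[ σ ∈ permsE (suc k′) n ] ∑[ α ∈ perms n ] ∑[ τ ∈ tuples n (perms m) ] term w (σ , α , τ) ≈⟨ coeff-PfШ w ⟨
    coeff w (PfШ n 𝐒 i)                                              ∎
    where
    F : (Fin N → Fin N) → Carrier
    F π = sgn π * 𝟙[ w ≡ wordOf π ]

    F-cong : ∀ {π π₁} → (∀ x → π x ≡ π₁ x) → F π ≈ F π₁
    F-cong π≗π₁ = reflexive (≡.cong₂ (λ s v → s * 𝟙[ w ≡ v ]) (sign-cong π≗π₁)
      (List.tabulate-cong (λ q → Vec.tabulate-cong (λ r → ≡.cong i (π≗π₁ (combine q r))))))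

    assembled-term : ∀ t → validTriple t ≡ true → term w t ≈ F (assemble t)
    assembled-term (σ , α , τ) h = let (_ , σ-inj , α-inj , τ-inj) = valid⇒ {σ} {α} {τ} h in term-assemble σ-inj α-inj τ-inj w

open import Data.Nat using (_*_; _≤_; _<_)
import Data.Fin

mainTheorem9 : ∀ {c ℓ : Level} (R : CommutativeRing c ℓ) (k n : ℕ) → 1 ≤ k → 1 ≤ n
    → (i : Fin (n * (2 * k)) → ℕ)
    → (∀ a b → a Data.Fin.< b → i a < i b)
    → (∀ a → 1 ≤ i a)
    → Setting._≋_ R k (Setting.lhs R k n i) (Setting.PfШ R k n (Setting.𝐒 R k) i)
mainTheorem9 R zero     n ()    _ i _ _
mainTheorem9 R (suc k′) n _   _ i _ _ = ShuffleHyperpfaffian.coeff-lhs≈coeff-PfШ R k′ n i
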